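{- Let $n \geq 1$ and write $n = 2^{j_1} + 2^{j_2} + \cdots + 2^{j_k}$ with $0 \leq j_1 < j_2 < \cdots < j_k$. For $t \in \mathbf{Z}$ let $$\mathcal{K}_n^{(t)}(x) = \sum_{j=0}^{n} (-2)^j \binom{t-j}{n-j}\binom{x}{j} \in \mathbf{Q}[x].$$ Then for every integer $t$ with $n \leq t < n + 2^{j_1}$, the $2$-adic Newton polygon of $\mathcal{K}_n^{(t)}(x)$ is degree-based, i.e. it consists, read from left to right, of segments of horizontal lengths $2^{j_1}, 2^{j_2}, \dots, 2^{j_k}$ with slopes $-2^{ -j_1}, -2^{ -j_2}, \dots, -2^{ -j_k}$, respectively.
   Context: Here $\binom{x}{j} = \frac{x(x-1)\cdots(x-j+1)}{j!}$. For a polynomial $f(x) = \sum_{j=0}^{n} a_j x^j \in \mathbf{Q}[x]$ of degree $n$ and a prime $p$, the $p$-adic Newton polygon $\operatorname{NP}_p(f)$ is the lower convex hull of the points $(n-j, v_p(a_j))$ for those $j$ with $a_j \neq 0$, where $v_p$ is the $p$-adic valuation. (Thus the leftmost point corresponds to the leading coefficient and the rightmost to the constant coefficient.) -}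

module Defs where

open import Data.Nat as ℕ using (ℕ; zero; suc; _%_; ⌊_/2⌋; _∸_)
open import Data.Nat.Combinatorics using (_C_)
open import Data.Integer as ℤ using (ℤ; +_; -[1+_])
open import Data.Rational using (ℚ; _+_; _*_; _-_; -_; _/_; _≤_; _<_; _⊓_; _⊔_; ½; 0ℚ; 1ℚ; ↥_; ↧ₙ_)
open import Data.List using (List; []; _∷_)
open import Data.Product using (Σ; _×_; ∃; _,_)
open import Data.Sum using (_⊎_)
open import Relation.Binary.PropositionalEquality using (_≡_)
open import Relation.Nullary using (¬_)

ℕ→ℚ : ℕ → ℚ
ℕ→ℚ m = + m / 1

ℤ→ℚ : ℤ → ℚ
ℤ→ℚ z = z / 1

_^ℚ_ : ℚ → ℕ → ℚ
q ^ℚ zero  = 1ℚ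
q ^ℚ suc m = q * (q ^ℚ m)

-- v₂ on ℕ (with fuel; fuel m suffices for argument m); v₂ 0 = 0 by
-- convention (never used on 0 below).
v₂-go : ℕ → ℕ → ℕ
v₂-go zero    m       = 0
v₂-go (suc f) zero    = 0
v₂-go (suc f) (suc m) with suc m % 2
... | zero  = suc (v₂-go f ⌊ suc m /2⌋)
... | suc _ = 0

v₂ℕ : ℕ → ℕ
v₂ℕ m = v₂-go m m

v₂ : ℚ → ℤ
v₂ q = (+ v₂ℕ ℤ.∣ ↥ q ∣) ℤ.- (+ v₂ℕ (↧ₙ q))

-- Polynomials in ℚ[x] as coefficient functions (index i ↦ coeff of x^i)

Poly : Set
Poly = ℕ → ℚ

one : Poly
one zero    = 1ℚ
one (suc i) = 0ℚ

shiftX : Poly → Poly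
shiftX p zero    = 0ℚ
shiftX p (suc i) = p i

mulXminus : ℚ → Poly → Poly
mulXminus c p i = shiftX p i - c * p i

scale : ℚ → Poly → Poly
scale c p i = c * p i

addP : Poly → Poly → Poly
addP p q i = p i + q i

zeroP : Poly
zeroP i = 0ℚ

-- binomPoly j = binom(x, j) = x(x-1)...(x-j+1)/j!, built by
-- binom(x, j+1) = binom(x, j) * (x - j) / (j+1)
binomPoly : ℕ → Poly
binomPoly zero    = one
binomPoly (suc j) = scale (+ 1 / suc j) (mulXminus (ℕ→ℚ j) (binomPoly j))

-- K_n^{(t)}(x) = Σ_{j=0}^{n} (-2)^j C(t-j, n-j) binom(x, j)
-- (for t ≥ n, so that t - j and n - j are natural numbers)
Kterm : ℕ → ℕ → ℕ → Poly
Kterm n t j = scale (((- ℕ→ℚ 2) ^ℚ j) * ℕ→ℚ ((t ∸ j) C (n ∸ j))) (binomPoly j)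

Ksum : ℕ → ℕ → ℕ → Poly
Ksum n t zero    = Kterm n t zero
Ksum n t (suc m) = addP (Ksum n t m) (Kterm n t (suc m))

K : ℕ → ℕ → Poly
K n t = Ksum n t n

-- The p-adic (p = 2) Newton polygon of a polynomial f of degree n:
-- lower convex hull of the points (n - j, v₂(a_j)), j ≤ n, a_j ≠ 0.

ptX : ℕ → ℕ → ℚ
ptX n j = ℕ→ℚ (n ∸ j)

ptY : Poly → ℕ → ℚ
ptY f j = ℤ→ℚ (v₂ (f j))

InSupp : ℕ → Poly → ℕ → Set
InSupp n f j = (j ℕ.≤ n) × ¬ (f j ≡ 0ℚ)

OnChord : ℕ → Poly → ℕ → ℕ → ℚ → ℚ → Set
OnChord n f j₁ j₂ x y =
  (ptX n j₁ ≤ x) × (x ≤ ptX n j₂) ×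
  ((ptX n j₂ - ptX n j₁) * y ≡ (ptX n j₂ - x) * ptY f j₁ + (x - ptX n j₁) * ptY f j₂)

BelowChord : ℕ → Poly → ℕ → ℕ → ℚ → ℚ → Set
BelowChord n f j₁ j₂ x y =
  (ptX n j₂ - ptX n j₁) * y ≤ (ptX n j₂ - x) * ptY f j₁ + (x - ptX n j₁) * ptY f j₂

-- NP n f x y : the 2-adic Newton polygon of f (degree n) passes through
-- (x, y), i.e. y is the minimum of the lower convex hull of the point set
-- above the abscissa x.  (For a finite planar point set this minimum is
-- attained on a point or on a chord between two points, and it is a
-- lower bound for all points/chords over x.)
NP : ℕ → Poly → ℚ → ℚ → Set
NP n f x y =
  ( (Σ ℕ λ j → InSupp n f j × (ptX n j ≡ x) × (y ≡ ptY f j))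
  ⊎ (Σ ℕ λ j₁ → Σ ℕ λ j₂ → InSupp n f j₁ × InSupp n f j₂ ×
       (ptX n j₁ < ptX n j₂) × OnChord n f j₁ j₂ x y) )
  ×
  ( (∀ j → InSupp n f j → ptX n j ≡ x → y ≤ ptY f j)
  × (∀ j₁ j₂ → InSupp n f j₁ → InSupp n f j₂ → ptX n j₁ < ptX n j₂ →
       ptX n j₁ ≤ x → x ≤ ptX n j₂ → BelowChord n f j₁ j₂ x y) )

-- The "degree-based" profile: starting at height y₀ at abscissa s,
-- successive segments of horizontal length 2^{j} and slope -2^{-j}
-- for j in the given list, read left to right.

clamp01 : ℚ → ℚ
clamp01 q = 1ℚ ⊓ (0ℚ ⊔ q)

pow2 : ℕ → ℕ
pow2 j = 2 ℕ.^ j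

profile : ℚ → ℚ → List ℕ → ℚ → ℚ
profile y₀ s []       x = y₀
profile y₀ s (j ∷ js) x =
  profile (y₀ - clamp01 ((x - s) * (½ ^ℚ j))) (s + ℕ→ℚ (pow2 j)) js x

-- The coefficient a_i of x^i in K_n^(t) is Σ_{i ≤ j ≤ n} (−2)^j C(t−j, n−j) s(j, i) / j!, with s(j, i)
-- the Stirling numbers of the first kind. By Legendre's formula v₂(j!) = j − s₂(j), so the j-th term
-- has valuation at least s₂(j), the binary digit sum of j.
-- For each binary digit 2^b of n write n = lo + 2^b h with lo < 2^b and h = 2g + 1. The digit sum
-- satisfies 2^b s₂(h) + j ≤ 2^b (s₂(j) + h) for all j < 2^b (h + 1), so every point (n − i, v₂(a_i))
-- lies on or above the line through (lo, s₂(h)) of slope −2^−b. The line passes through the points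
-- of i = 2^b h and i = 2^(b+1) g, at abscissae lo and lo + 2^b: there the term j = i has valuation
-- exactly s₂(i), as s(i, i) = 1 and C(t−i, n−i) is odd by Lucas' theorem (2^j₁ divides n − i and
-- t − n < 2^j₁), while all other terms have larger valuation. These segments, one for each binary
-- digit of n, make up the degree-based polygon.

module Submission where

module BinaryDigits where

  open import Data.Nat
  open import Data.Nat.Properties
  open import Data.Nat.Divisibility using (_∣_; divides)
  open import Data.Nat.Combinatorics using (_C_; k![n∸k]!∣n!)
  open import Data.Nat.Combinatorics.Specification using (nCk≡n!/k![n-k]!)
  open import Data.Nat.DivMod using (m*n%n≡0; [m+kn]%n≡m%n; m/n*n≡m)
  open import Data.Nat.Induction using (<-rec)
  open import Data.Nat.Tactic.RingSolver using (solve-∀)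
  open import Data.Product using (Σ; _×_; _,_)
  open import Data.Empty using (⊥-elim)
  open import Data.List using ([]; _∷_; map; length)
  open import Data.List.Relation.Unary.Linked using (Linked; _∷_)
  open import Data.Nat.ListAction using (sum)
  open import Defs using (pow2)
  open import Relation.Binary.PropositionalEquality

  data EvenOrOdd : ℕ → Set where
    even : ∀ m → EvenOrOdd (2 * m)
    odd  : ∀ m → EvenOrOdd (suc (2 * m))

  evenOrOdd : ∀ n → EvenOrOdd n
  evenOrOdd zero = even 0
  evenOrOdd (suc n) with evenOrOdd n
  ... | even m = odd m
  ... | odd m  = subst EvenOrOdd (*-suc 2 m) (even (suc m))

  Odd : ℕ → Set
  Odd u = Σ ℕ λ w → u ≡ suc (2 * w)

  Odd-* : ∀ {a b} → Odd a → Odd b → Odd (a * b)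
  Odd-* (w , refl) (v , refl) = w + v + 2 * w * v , expand w v
    where
    expand : ∀ w v → suc (2 * w) * suc (2 * v) ≡ suc (2 * (w + v + 2 * w * v))
    expand = solve-∀

  Odd⇒>0 : ∀ {u} → Odd u → 0 < u
  Odd⇒>0 (w , refl) = z<s

  even≢odd′ : ∀ p u {v} → Odd v → 2 ^ suc p * u ≢ v
  even≢odd′ p u (w , refl) eq = even≢odd (2 ^ p * u) w (trans (sym (*-assoc 2 (2 ^ p) u)) eq)

  pow2*odd-injective : ∀ {p q u v} → Odd u → Odd v → 2 ^ p * u ≡ 2 ^ q * v → p ≡ q
  pow2*odd-injective {zero}  {zero}          _  _  _  = refl
  pow2*odd-injective {zero}  {suc q} {u} {v} ou _  eq = ⊥-elim (even≢odd′ q v ou (trans (sym eq) (*-identityˡ u)))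
  pow2*odd-injective {suc p} {zero}  {u} {v} _  ov eq = ⊥-elim (even≢odd′ p u ov (trans eq (*-identityˡ v)))
  pow2*odd-injective {suc p} {suc q} {u} {v} ou ov eq = cong suc (pow2*odd-injective ou ov
    (*-cancelˡ-≡ _ _ 2 (trans (sym (*-assoc 2 (2 ^ p) u)) (trans eq (*-assoc 2 (2 ^ q) v)))))

  Pow2*Odd : ℕ → Set
  Pow2*Odd m = Σ ℕ λ p → Σ ℕ λ u → Odd u × m ≡ 2 ^ p * u

  pow2*odd : ∀ m → Pow2*Odd (suc m)
  pow2*odd = <-rec (λ m → Pow2*Odd (suc m)) split
    where
    split : ∀ m → (∀ {k} → k < m → Pow2*Odd (suc k)) → Pow2*Odd (suc m)
    split m rec with evenOrOdd m
    ... | even k = 0 , suc (2 * k) , (k , refl) , sym (*-identityˡ _)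
    ... | odd k with rec {k} (s≤s (m≤m+n k _))
    ...   | p , u , ou , eq = suc p , u , ou ,
            trans (sym (*-suc 2 k)) (trans (cong (2 *_) eq) (sym (*-assoc 2 (2 ^ p) u)))

  2*m%2≡0 : ∀ m → 2 * m % 2 ≡ 0
  2*m%2≡0 m = trans (cong (_% 2) (*-comm 2 m)) (m*n%n≡0 m 2)

  [1+2*m]%2≡1 : ∀ m → suc (2 * m) % 2 ≡ 1
  [1+2*m]%2≡1 m = trans (cong (λ k → suc k % 2) (*-comm 2 m)) ([m+kn]%n≡m%n 1 m 2)

  ⌊2*m/2⌋≡m : ∀ m → ⌊ 2 * m /2⌋ ≡ m
  ⌊2*m/2⌋≡m m = sym (trans (n≡⌊n+n/2⌋ m) (cong (λ k → ⌊ m + k /2⌋) (sym (+-identityʳ m))))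

  ⌊1+2*m/2⌋≡m : ∀ m → ⌊ suc (2 * m) /2⌋ ≡ m
  ⌊1+2*m/2⌋≡m m = sym (trans (n≡⌈n+n/2⌉ m) (cong (λ k → ⌈ m + k /2⌉) (sym (+-identityʳ m))))

  s₂-fuel : ℕ → ℕ → ℕ
  s₂-fuel zero    m = 0
  s₂-fuel (suc f) m = m % 2 + s₂-fuel f ⌊ m /2⌋

  s₂-fuel-0 : ∀ f → s₂-fuel f 0 ≡ 0
  s₂-fuel-0 zero    = refl
  s₂-fuel-0 (suc f) = s₂-fuel-0 f

  s₂-fuel-enough : ∀ {f g} m → m ≤ f → m ≤ g → s₂-fuel f m ≡ s₂-fuel g m
  s₂-fuel-enough {f} {g} zero _ _ = trans (s₂-fuel-0 f) (sym (s₂-fuel-0 g))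
  s₂-fuel-enough {suc f} {suc g} (suc m) (s≤s m≤f) (s≤s m≤g) = cong (suc m % 2 +_)
    (s₂-fuel-enough ⌊ suc m /2⌋ (≤-trans half≤m m≤f) (≤-trans half≤m m≤g))
    where
    half≤m : ⌊ suc m /2⌋ ≤ m
    half≤m = s≤s⁻¹ (⌊n/2⌋<n m)

  -- It is opaque so that it only
  -- unfolds through s₂-0 and s₂-unfold: otherwise Agda normalises s₂ inside rational expressions,
  -- which exhausts memory.
  opaque
    s₂ : ℕ → ℕ
    s₂ m = s₂-fuel m m

    s₂-0 : s₂ 0 ≡ 0
    s₂-0 = refl

    s₂-unfold : ∀ m → s₂ m ≡ m % 2 + s₂ ⌊ m /2⌋
    s₂-unfold zero    = refl
    s₂-unfold (suc m) = cong (suc m % 2 +_) (s₂-fuel-enough _ (s≤s⁻¹ (⌊n/2⌋<n m)) ≤-refl)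

  s₂-2* : ∀ m → s₂ (2 * m) ≡ s₂ m
  s₂-2* m = trans (s₂-unfold (2 * m)) (cong₂ _+_ (2*m%2≡0 m) (cong s₂ (⌊2*m/2⌋≡m m)))

  s₂-1+2* : ∀ m → s₂ (suc (2 * m)) ≡ suc (s₂ m)
  s₂-1+2* m = trans (s₂-unfold (suc (2 * m))) (cong₂ _+_ ([1+2*m]%2≡1 m) (cong s₂ (⌊1+2*m/2⌋≡m m)))

  s₂-split : ∀ c y r → r < 2 ^ c → s₂ (2 ^ c * y + r) ≡ s₂ y + s₂ r
  s₂-split zero y zero    _        = trans (cong s₂ (trans (+-identityʳ _) (*-identityˡ y)))
    (sym (trans (cong (s₂ y +_) s₂-0) (+-identityʳ (s₂ y))))
  s₂-split zero y (suc r) (s≤s ())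
  s₂-split (suc c) y r r<2^c+1 with evenOrOdd r
  ... | even m = begin
    s₂ (2 ^ suc c * y + 2 * m)  ≡⟨ cong s₂ (shift (2 ^ c) y m) ⟩
    s₂ (2 * (2 ^ c * y + m))    ≡⟨ s₂-2* (2 ^ c * y + m) ⟩
    s₂ (2 ^ c * y + m)          ≡⟨ s₂-split c y m (*-cancelˡ-< 2 m (2 ^ c) r<2^c+1) ⟩
    s₂ y + s₂ m                 ≡⟨ cong (s₂ y +_) (s₂-2* m) ⟨
    s₂ y + s₂ (2 * m)           ∎
    where
    open ≡-Reasoning
    shift : ∀ P y m → 2 * P * y + 2 * m ≡ 2 * (P * y + m)
    shift = solve-∀
  ... | odd m = begin
    s₂ (2 ^ suc c * y + suc (2 * m))  ≡⟨ cong s₂ (shift (2 ^ c) y m) ⟩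
    s₂ (suc (2 * (2 ^ c * y + m)))    ≡⟨ s₂-1+2* (2 ^ c * y + m) ⟩
    suc (s₂ (2 ^ c * y + m))          ≡⟨ cong suc (s₂-split c y m (*-cancelˡ-< 2 m (2 ^ c) (<-trans (n<1+n _) r<2^c+1))) ⟩
    suc (s₂ y + s₂ m)                 ≡⟨ +-suc (s₂ y) (s₂ m) ⟨
    s₂ y + suc (s₂ m)                 ≡⟨ cong (s₂ y +_) (s₂-1+2* m) ⟨
    s₂ y + s₂ (suc (2 * m))           ∎
    where
    open ≡-Reasoning
    shift : ∀ P y m → 2 * P * y + suc (2 * m) ≡ suc (2 * (P * y + m))
    shift = solve-∀

  s₂-2^* : ∀ c y → s₂ (2 ^ c * y) ≡ s₂ y
  s₂-2^* c y = trans (cong s₂ (sym (+-identityʳ (2 ^ c * y))))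
    (trans (s₂-split c y 0 (m^n>0 2 c)) (trans (cong (s₂ y +_) s₂-0) (+-identityʳ (s₂ y))))

  -- Adding 1 to j clears its e trailing binary ones and sets one digit, where 2^e exactly divides j + 1.
  s₂-suc : ∀ e {j u} → Odd u → suc j ≡ 2 ^ e * u → s₂ (suc j) + e ≡ suc (s₂ j)
  s₂-suc zero {j} (w , refl) eq with suc-injective (trans eq (*-identityˡ _))
  ... | refl = trans (+-identityʳ _) (trans (s₂-1+2* w) (cong suc (sym (s₂-2* w))))
  s₂-suc (suc e) {j} {u} ou eq with evenOrOdd j
  ... | even m = ⊥-elim (even≢odd′ e u (m , refl) (sym eq))
  ... | odd m  = begin
    s₂ (2 + 2 * m) + suc e    ≡⟨ cong (λ k → s₂ k + suc e) (*-suc 2 m) ⟨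
    s₂ (2 * suc m) + suc e    ≡⟨ cong (_+ suc e) (s₂-2* (suc m)) ⟩
    s₂ (suc m) + suc e        ≡⟨ +-suc (s₂ (suc m)) e ⟩
    suc (s₂ (suc m) + e)      ≡⟨ cong suc (s₂-suc e ou halved) ⟩
    suc (suc (s₂ m))          ≡⟨ cong suc (s₂-1+2* m) ⟨
    suc (s₂ (suc (2 * m)))    ∎
    where
    open ≡-Reasoning
    halved : suc m ≡ 2 ^ e * u
    halved = *-cancelˡ-≡ (suc m) (2 ^ e * u) 2 (trans (*-suc 2 m) (trans eq (*-assoc 2 (2 ^ e) u)))

  s₂-suc-≤ : ∀ j → s₂ (suc j) ≤ suc (s₂ j)
  s₂-suc-≤ j with pow2*odd j
  ... | e , u , ou , eq = subst (s₂ (suc j) ≤_) (s₂-suc e ou eq) (m≤m+n (s₂ (suc j)) e)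

  m≤n⇒s₂n+m≤s₂m+n : ∀ {m n} → m ≤ n → s₂ n + m ≤ s₂ m + n
  m≤n⇒s₂n+m≤s₂m+n {m} m≤n = subst (λ n → s₂ n + m ≤ s₂ m + n) (m+[n∸m]≡n m≤n) (steps (_ ∸ m))
    where
    open ≤-Reasoning
    steps : ∀ d → s₂ (m + d) + m ≤ s₂ m + (m + d)
    steps zero rewrite +-identityʳ m = ≤-refl
    steps (suc d) = begin
      s₂ (m + suc d) + m        ≡⟨ cong (λ k → s₂ k + m) (+-suc m d) ⟩
      s₂ (suc (m + d)) + m      ≤⟨ +-monoˡ-≤ m (s₂-suc-≤ (m + d)) ⟩
      suc (s₂ (m + d) + m)      ≤⟨ s≤s (steps d) ⟩
      suc (s₂ m + (m + d))      ≡⟨ +-suc (s₂ m) (m + d) ⟨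
      s₂ m + suc (m + d)        ≡⟨ cong (s₂ m +_) (+-suc m d) ⟨
      s₂ m + (m + suc d)        ∎

  legendre : ∀ j → Σ ℕ λ w → Σ ℕ λ o → Odd o × j ! ≡ 2 ^ w * o × w + s₂ j ≡ j
  legendre zero = 0 , 1 , (0 , refl) , refl , s₂-0
  legendre (suc j) with pow2*odd j | legendre j
  ... | e , u , ou , eq | w , o , oo , j!≡ , w+s₂j≡j = w + e , u * o , Odd-* ou oo ,
    (begin
      suc j * j !                ≡⟨ cong₂ _*_ eq j!≡ ⟩
      (2 ^ e * u) * (2 ^ w * o)  ≡⟨ regroup (2 ^ e) (2 ^ w) u o ⟩
      (2 ^ w * 2 ^ e) * (u * o)  ≡⟨ cong (_* (u * o)) (^-distribˡ-+-* 2 w e) ⟨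
      2 ^ (w + e) * (u * o)      ∎) ,
    (begin
      w + e + s₂ (suc j)         ≡⟨ +-assoc w e _ ⟩
      w + (e + s₂ (suc j))       ≡⟨ cong (w +_) (trans (+-comm e _) (s₂-suc e ou eq)) ⟩
      w + suc (s₂ j)             ≡⟨ +-suc w (s₂ j) ⟩
      suc (w + s₂ j)             ≡⟨ cong suc w+s₂j≡j ⟩
      suc j                      ∎)
    where
    open ≡-Reasoning
    regroup : ∀ E W u o → (E * u) * (W * o) ≡ (W * E) * (u * o)
    regroup = solve-∀

  s₂-above-line : ∀ b {N h} → N < 2 ^ b * suc h → 2 ^ b * s₂ h + N ≤ 2 ^ b * (s₂ N + h)
  s₂-above-line zero {N} {h} N<h+1 = begin
    1 * s₂ h + N      ≡⟨ cong (_+ N) (*-identityˡ (s₂ h)) ⟩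
    s₂ h + N          ≤⟨ m≤n⇒s₂n+m≤s₂m+n (s≤s⁻¹ (subst (N <_) (*-identityˡ (suc h)) N<h+1)) ⟩
    s₂ N + h          ≡⟨ *-identityˡ (s₂ N + h) ⟨
    1 * (s₂ N + h)    ∎
    where open ≤-Reasoning
  s₂-above-line (suc b) {N} {h} N<bound with evenOrOdd N
  ... | even m = begin
    2 * P * s₂ h + 2 * m       ≡⟨ factor P (s₂ h) m ⟩
    2 * (P * s₂ h + m)         ≤⟨ *-monoʳ-≤ 2 (s₂-above-line b (halve N<bound)) ⟩
    2 * (P * (s₂ m + h))       ≡⟨ cong (λ k → 2 * (P * (k + h))) (s₂-2* m) ⟨
    2 * (P * (s₂ (2 * m) + h)) ≡⟨ *-assoc 2 P _ ⟨
    2 * P * (s₂ (2 * m) + h)   ∎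
    where
    open ≤-Reasoning
    P : ℕ
    P = 2 ^ b
    halve : 2 * m < 2 * P * suc h → m < P * suc h
    halve lt = *-cancelˡ-< 2 m (P * suc h) (subst (2 * m <_) (*-assoc 2 P (suc h)) lt)
    factor : ∀ P s m → 2 * P * s + 2 * m ≡ 2 * (P * s + m)
    factor = solve-∀
  ... | odd m = begin
    2 * P * s₂ h + suc (2 * m)               ≡⟨ factor P (s₂ h) m ⟩
    2 * (P * s₂ h + m) + 1                   ≤⟨ +-mono-≤ (*-monoʳ-≤ 2 (s₂-above-line b (halve N<bound))) 1≤2P ⟩
    2 * (P * (s₂ m + h)) + 2 * P             ≡⟨ expand P (s₂ m) h ⟩
    2 * P * (suc (s₂ m) + h)                 ≡⟨ cong (λ k → 2 * P * (k + h)) (s₂-1+2* m) ⟨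
    2 * P * (s₂ (suc (2 * m)) + h)           ∎
    where
    open ≤-Reasoning
    P : ℕ
    P = 2 ^ b
    halve : suc (2 * m) < 2 * P * suc h → m < P * suc h
    halve lt = *-cancelˡ-< 2 m (P * suc h) (subst (2 * m <_) (*-assoc 2 P (suc h)) (<-trans (n<1+n _) lt))
    1≤2P : 1 ≤ 2 * P
    1≤2P = ≤-trans (m^n>0 2 b) (m≤n*m P 2)
    factor : ∀ P s m → 2 * P * s + suc (2 * m) ≡ 2 * (P * s + m) + 1
    factor = solve-∀
    expand : ∀ P s h → 2 * (P * (s + h)) + 2 * P ≡ 2 * P * (suc s + h)
    expand = solve-∀

  Odd[m*n]⇒Odd[m] : ∀ m {n} → Odd (m * n) → Odd m
  Odd[m*n]⇒Odd[m] m {n} (w , eq) with evenOrOdd m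
  ... | odd k  = k , refl
  ... | even k = ⊥-elim (even≢odd (k * n) w (trans (sym (*-assoc 2 k n)) eq))

  2^-mono-∣ : ∀ {m n} → m ≤ n → 2 ^ m ∣ 2 ^ n
  2^-mono-∣ {m} {n} m≤n = divides (2 ^ (n ∸ m)) (begin
    2 ^ n                ≡⟨ cong (2 ^_) (m+[n∸m]≡n m≤n) ⟨
    2 ^ (m + (n ∸ m))    ≡⟨ ^-distribˡ-+-* 2 m (n ∸ m) ⟩
    2 ^ m * 2 ^ (n ∸ m)  ≡⟨ *-comm (2 ^ m) _ ⟩
    2 ^ (n ∸ m) * 2 ^ m  ∎)
    where open ≡-Reasoning

  C*k!*[n∸k]!≡n! : ∀ {n k} → k ≤ n → (n C k) * (k ! * (n ∸ k) !) ≡ n !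
  C*k!*[n∸k]!≡n! {n} {k} k≤n =
    trans (cong (_* (k ! * (n ∸ k) !)) (nCk≡n!/k![n-k]! k≤n)) (m/n*n≡m (k![n∸k]!∣n! k≤n))
    where
    instance
      k!*[n∸k]!≢0 : NonZero (k ! * (n ∸ k) !)
      k!*[n∸k]!≢0 = k !* (n ∸ k) !≢0

  -- A special case of Lucas' theorem: no carries occur when adding r < 2^c to a multiple of 2^c.
  C-odd : ∀ {c M r} → 2 ^ c ∣ M → r < 2 ^ c → Odd ((M + r) C M)
  C-odd {c} {r = r} (divides y refl) r<2^c
    with legendre (y * 2 ^ c) | legendre r | legendre (y * 2 ^ c + r)
  ... | w₁ , o₁ , _ , M!≡ , w₁+s₂M≡M | w₂ , o₂ , _ , r!≡ , w₂+s₂r≡r | w₃ , o₃ , oo₃ , T!≡ , w₃+s₂T≡T =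
    Odd[m*n]⇒Odd[m] binom (subst Odd (sym odd-parts) oo₃)
    where
    M T binom : ℕ
    M = y * 2 ^ c
    T = M + r
    binom = T C M
    s₂M≡s₂y : s₂ M ≡ s₂ y
    s₂M≡s₂y = trans (cong s₂ (*-comm y (2 ^ c))) (s₂-2^* c y)
    s₂T : s₂ T ≡ s₂ M + s₂ r
    s₂T = trans (cong (λ k → s₂ (k + r)) (*-comm y (2 ^ c))) (trans (s₂-split c y r r<2^c) (cong (_+ s₂ r) (sym s₂M≡s₂y)))
    w₃≡ : w₃ ≡ w₁ + w₂
    w₃≡ = +-cancelʳ-≡ (s₂ M + s₂ r) w₃ (w₁ + w₂) (begin
      w₃ + (s₂ M + s₂ r)         ≡⟨ cong (w₃ +_) s₂T ⟨
      w₃ + s₂ T                  ≡⟨ w₃+s₂T≡T ⟩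
      M + r                      ≡⟨ cong₂ _+_ w₁+s₂M≡M w₂+s₂r≡r ⟨
      w₁ + s₂ M + (w₂ + s₂ r)    ≡⟨ interchange w₁ w₂ (s₂ M) (s₂ r) ⟩
      w₁ + w₂ + (s₂ M + s₂ r)    ∎)
      where
      open ≡-Reasoning
      interchange : ∀ a b c d → a + c + (b + d) ≡ a + b + (c + d)
      interchange = solve-∀
    T!≡C*M!*r! : binom * (M ! * r !) ≡ T !
    T!≡C*M!*r! = trans (cong (λ k → binom * (M ! * k !)) (sym (m+n∸m≡n M r))) (C*k!*[n∸k]!≡n! (m≤m+n M r))
    odd-parts : binom * (o₁ * o₂) ≡ o₃
    odd-parts = *-cancelˡ-≡ _ _ (2 ^ (w₁ + w₂)) {{m^n≢0 2 (w₁ + w₂)}} (begin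
      2 ^ (w₁ + w₂) * (binom * (o₁ * o₂))     ≡⟨ cong (_* (binom * (o₁ * o₂))) (^-distribˡ-+-* 2 w₁ w₂) ⟩
      2 ^ w₁ * 2 ^ w₂ * (binom * (o₁ * o₂))   ≡⟨ regroup (2 ^ w₁) (2 ^ w₂) binom o₁ o₂ ⟩
      binom * ((2 ^ w₁ * o₁) * (2 ^ w₂ * o₂)) ≡⟨ cong (binom *_) (cong₂ _*_ M!≡ r!≡) ⟨
      binom * (M ! * r !)                     ≡⟨ T!≡C*M!*r! ⟩
      T !                                     ≡⟨ T!≡ ⟩
      2 ^ w₃ * o₃                             ≡⟨ cong (λ w → 2 ^ w * o₃) w₃≡ ⟩
      2 ^ (w₁ + w₂) * o₃                      ∎)
      where
      open ≡-Reasoning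
      regroup : ∀ A B C o p → A * B * (C * (o * p)) ≡ C * ((A * o) * (B * p))
      regroup = solve-∀

  sum-increasing-pow2 : ∀ b L → Linked _<_ (b ∷ L) →
    Σ ℕ λ g → sum (map pow2 (b ∷ L)) ≡ pow2 b * suc (2 * g) × s₂ (suc (2 * g)) ≡ length (b ∷ L)
  sum-increasing-pow2 b []       _ = 0 , trans (+-identityʳ (pow2 b)) (sym (*-identityʳ (pow2 b))) ,
    trans (s₂-1+2* 0) (cong suc s₂-0)
  sum-increasing-pow2 b (b′ ∷ L) (b<b′ ∷ increasing) with sum-increasing-pow2 b′ L increasing
  ... | g′ , sum≡ , s₂≡ = pow2 d * suc (2 * g′) ,
    (begin
      pow2 b + sum (map pow2 (b′ ∷ L))          ≡⟨ cong (pow2 b +_) sum≡ ⟩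
      pow2 b + pow2 b′ * suc (2 * g′)           ≡⟨ cong (λ k → pow2 b + pow2 k * suc (2 * g′)) b′≡ ⟩
      pow2 b + 2 ^ (suc b + d) * suc (2 * g′)   ≡⟨ cong (λ k → pow2 b + k * suc (2 * g′)) (^-distribˡ-+-* 2 (suc b) d) ⟩
      pow2 b + 2 * pow2 b * pow2 d * suc (2 * g′) ≡⟨ factor (pow2 b) (pow2 d) g′ ⟩
      pow2 b * suc (2 * (pow2 d * suc (2 * g′))) ∎) ,
    trans (s₂-1+2* (pow2 d * suc (2 * g′))) (cong suc (trans (s₂-2^* d (suc (2 * g′))) s₂≡))
    where
    open ≡-Reasoning
    d : ℕ
    d = b′ ∸ suc b
    b′≡ : b′ ≡ suc b + d
    b′≡ = sym (m+[n∸m]≡n b<b′)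
    factor : ∀ B D g → B + 2 * B * D * suc (2 * g) ≡ B * suc (2 * (D * suc (2 * g)))
    factor = solve-∀

module RationalCasts where

  open import Level using (0ℓ)
  open import Data.Integer as ℤ using (ℤ; +_)
  import Data.Integer.Properties as ℤ
  import Data.Integer.Tactic.RingSolver as ℤ-Solver
  open import Data.Nat as ℕ using (ℕ)
  import Data.Nat.Properties as ℕ
  open import Data.Rational
  open import Data.Rational.Properties
  import Data.Rational.Unnormalised as ℚᵘ
  import Data.Rational.Unnormalised.Properties as ℚᵘ
  open import Relation.Binary.PropositionalEquality
  open import Relation.Nullary.Decidable.Core using (dec⇒maybe)
  import Tactic.RingSolver.Core.AlmostCommutativeRing as ACR
  open import Defs using (ℕ→ℚ; ℤ→ℚ)

  ℚ-ring : ACR.AlmostCommutativeRing 0ℓ 0ℓ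
  ℚ-ring = ACR.fromCommutativeRing +-*-commutativeRing (λ x → dec⇒maybe (0ℚ ≟ x))

  toℚᵘ-ℤ→ℚ : ∀ a → toℚᵘ (ℤ→ℚ a) ℚᵘ.≃ ℚᵘ.mkℚᵘ a 0
  toℚᵘ-ℤ→ℚ a = toℚᵘ-fromℚᵘ (ℚᵘ.mkℚᵘ a 0)

  ℤ→ℚ-+ : ∀ a b → ℤ→ℚ (a ℤ.+ b) ≡ ℤ→ℚ a + ℤ→ℚ b
  ℤ→ℚ-+ a b = toℚᵘ-injective (begin
    toℚᵘ (ℤ→ℚ (a ℤ.+ b))               ≈⟨ toℚᵘ-ℤ→ℚ (a ℤ.+ b) ⟩
    ℚᵘ.mkℚᵘ (a ℤ.+ b) 0                ≈⟨ ℚᵘ.*≡* (cross a b) ⟩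
    ℚᵘ.mkℚᵘ a 0 ℚᵘ.+ ℚᵘ.mkℚᵘ b 0       ≈⟨ ℚᵘ.+-cong (toℚᵘ-ℤ→ℚ a) (toℚᵘ-ℤ→ℚ b) ⟨
    toℚᵘ (ℤ→ℚ a) ℚᵘ.+ toℚᵘ (ℤ→ℚ b)     ≈⟨ toℚᵘ-homo-+ (ℤ→ℚ a) (ℤ→ℚ b) ⟨
    toℚᵘ (ℤ→ℚ a + ℤ→ℚ b)               ∎)
    where
    open ℚᵘ.≃-Reasoning
    cross : ∀ a b → (a ℤ.+ b) ℤ.* ℤ.1ℤ ≡ (a ℤ.* ℤ.1ℤ ℤ.+ b ℤ.* ℤ.1ℤ) ℤ.* ℤ.1ℤ
    cross = ℤ-Solver.solve-∀

  ℤ→ℚ-* : ∀ a b → ℤ→ℚ (a ℤ.* b) ≡ ℤ→ℚ a * ℤ→ℚ b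
  ℤ→ℚ-* a b = toℚᵘ-injective (begin
    toℚᵘ (ℤ→ℚ (a ℤ.* b))               ≈⟨ toℚᵘ-ℤ→ℚ (a ℤ.* b) ⟩
    ℚᵘ.mkℚᵘ (a ℤ.* b) 0                ≈⟨ ℚᵘ.*-cong (toℚᵘ-ℤ→ℚ a) (toℚᵘ-ℤ→ℚ b) ⟨
    toℚᵘ (ℤ→ℚ a) ℚᵘ.* toℚᵘ (ℤ→ℚ b)     ≈⟨ toℚᵘ-homo-* (ℤ→ℚ a) (ℤ→ℚ b) ⟨
    toℚᵘ (ℤ→ℚ a * ℤ→ℚ b)               ∎)
    where open ℚᵘ.≃-Reasoning

  ℤ→ℚ-neg : ∀ a → ℤ→ℚ (ℤ.- a) ≡ - ℤ→ℚ a
  ℤ→ℚ-neg a = toℚᵘ-injective (begin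
    toℚᵘ (ℤ→ℚ (ℤ.- a))   ≈⟨ toℚᵘ-ℤ→ℚ (ℤ.- a) ⟩
    ℚᵘ.- ℚᵘ.mkℚᵘ a 0     ≈⟨ ℚᵘ.-‿cong (toℚᵘ-ℤ→ℚ a) ⟨
    ℚᵘ.- toℚᵘ (ℤ→ℚ a)    ≈⟨ toℚᵘ-homo‿- (ℤ→ℚ a) ⟨
    toℚᵘ (- ℤ→ℚ a)       ∎)
    where open ℚᵘ.≃-Reasoning

  ℤ→ℚ-- : ∀ a b → ℤ→ℚ (a ℤ.- b) ≡ ℤ→ℚ a - ℤ→ℚ b
  ℤ→ℚ-- a b = trans (ℤ→ℚ-+ a (ℤ.- b)) (cong (_+_ (ℤ→ℚ a)) (ℤ→ℚ-neg b))

  ℕ→ℚ-+ : ∀ m n → ℕ→ℚ (m ℕ.+ n) ≡ ℕ→ℚ m + ℕ→ℚ n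
  ℕ→ℚ-+ m n = trans (cong ℤ→ℚ (ℤ.pos-+ m n)) (ℤ→ℚ-+ (+ m) (+ n))

  ℕ→ℚ-* : ∀ m n → ℕ→ℚ (m ℕ.* n) ≡ ℕ→ℚ m * ℕ→ℚ n
  ℕ→ℚ-* m n = trans (cong ℤ→ℚ (ℤ.pos-* m n)) (ℤ→ℚ-* (+ m) (+ n))

  ℤ→ℚ-mono-≤ : ∀ {a b} → a ℤ.≤ b → ℤ→ℚ a ≤ ℤ→ℚ b
  ℤ→ℚ-mono-≤ {a} {b} a≤b = toℚᵘ-cancel-≤ (ℚᵘ.≤-respʳ-≃ (ℚᵘ.≃-sym (toℚᵘ-ℤ→ℚ b))
    (ℚᵘ.≤-respˡ-≃ (ℚᵘ.≃-sym (toℚᵘ-ℤ→ℚ a)) (ℚᵘ.*≤* (ℤ.*-monoʳ-≤-nonNeg ℤ.1ℤ a≤b))))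

  ℤ→ℚ-mono-< : ∀ {a b} → a ℤ.< b → ℤ→ℚ a < ℤ→ℚ b
  ℤ→ℚ-mono-< {a} {b} a<b = toℚᵘ-cancel-< (ℚᵘ.<-respʳ-≃ (ℚᵘ.≃-sym (toℚᵘ-ℤ→ℚ b))
    (ℚᵘ.<-respˡ-≃ (ℚᵘ.≃-sym (toℚᵘ-ℤ→ℚ a)) (ℚᵘ.*<* (ℤ.*-monoʳ-<-pos ℤ.1ℤ a<b))))

  ℕ→ℚ-mono-≤ : ∀ {m n} → m ℕ.≤ n → ℕ→ℚ m ≤ ℕ→ℚ n
  ℕ→ℚ-mono-≤ m≤n = ℤ→ℚ-mono-≤ (ℤ.+≤+ m≤n)

  ℕ→ℚ-mono-< : ∀ {m n} → m ℕ.< n → ℕ→ℚ m < ℕ→ℚ n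
  ℕ→ℚ-mono-< m<n = ℤ→ℚ-mono-< (ℤ.+<+ m<n)

  *-cancelʳ-≡-pos : ∀ {p q} r → 0ℚ < r → p * r ≡ q * r → p ≡ q
  *-cancelʳ-≡-pos r r>0 eq = ≤-antisym (*-cancelʳ-≤-pos r (≤-reflexive eq)) (*-cancelʳ-≤-pos r (≤-reflexive (sym eq)))
    where
    instance
      r-positive : Positive r
      r-positive = positive r>0

module TwoAdicValuation where

  open import Data.Integer as ℤ using (ℤ; +_; -[1+_])
  import Data.Integer.Properties as ℤ
  import Data.Integer.Tactic.RingSolver as ℤ-Solver
  open import Data.Nat as ℕ using (ℕ; zero; suc; _^_)
  import Data.Nat.Properties as ℕ
  import Data.Nat.Tactic.RingSolver as ℕ-Solver
  open import Data.Rational using (ℚ; mkℚ; _+_; _*_; 0ℚ; ↥_; ↧_; ↧ₙ_; toℚᵘ)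
  open import Data.Rational.Properties
  import Data.Rational.Unnormalised as ℚᵘ
  import Data.Rational.Unnormalised.Properties as ℚᵘ
  open import Data.Product using (Σ; _×_; _,_)
  open import Data.Empty using (⊥-elim)
  open import Data.Sum using (inj₁; inj₂)
  open import Relation.Nullary using (yes; no)
  open import Relation.Binary.PropositionalEquality
  open import Tactic.RingSolver using (solve-∀)
  open import Function using (_$_)
  open import Defs using (ℕ→ℚ; ℤ→ℚ; v₂; v₂-go; v₂ℕ)
  open BinaryDigits
  open RationalCasts

  v₂-go-odd : ∀ f w → v₂-go (suc f) (suc (2 ℕ.* w)) ≡ 0
  v₂-go-odd f w rewrite [1+2*m]%2≡1 w = refl

  v₂-go-even : ∀ f X → v₂-go (suc f) (2 ℕ.* suc X) ≡ suc (v₂-go f (suc X))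
  v₂-go-even f X rewrite 2*m%2≡0 (suc X) = cong (λ k → suc (v₂-go f k)) (⌊2*m/2⌋≡m (suc X))

  v₂-go-2* : ∀ {X p} → 0 ℕ.< X → (∀ f → X ℕ.≤ f → v₂-go f X ≡ p) →
             ∀ f → 2 ℕ.* X ℕ.≤ f → v₂-go f (2 ℕ.* X) ≡ suc p
  v₂-go-2* {suc X} _ v₂X≡p (suc f) 2X≤f = trans (v₂-go-even f X) (cong suc (v₂X≡p f X≤f))
    where
    X≤f : suc X ℕ.≤ f
    X≤f = ℕ.≤-trans (ℕ.s≤s (ℕ.m≤m+n X (X ℕ.+ 0))) (ℕ.≤-trans (ℕ.≤-reflexive (sym (ℕ.+-suc X _))) (ℕ.s≤s⁻¹ 2X≤f))

  v₂-go-pow2*odd : ∀ p {u} → Odd u → ∀ f → 2 ^ p ℕ.* u ℕ.≤ f → v₂-go f (2 ^ p ℕ.* u) ≡ p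
  v₂-go-pow2*odd zero (w , refl) (suc f) _ = trans (cong (v₂-go (suc f)) (ℕ.*-identityˡ _)) (v₂-go-odd f w)
  v₂-go-pow2*odd (suc p) {u} ou f ≤f = trans (cong (v₂-go f) assoc)
    (v₂-go-2* (ℕ.*-mono-≤ (ℕ.m^n>0 2 p) (Odd⇒>0 ou)) (v₂-go-pow2*odd p ou) f (subst (ℕ._≤ f) assoc ≤f))
    where
    assoc : 2 ^ suc p ℕ.* u ≡ 2 ℕ.* (2 ^ p ℕ.* u)
    assoc = ℕ.*-assoc 2 (2 ^ p) u

  v₂ℕ-pow2*odd : ∀ p {u} → Odd u → v₂ℕ (2 ^ p ℕ.* u) ≡ p
  v₂ℕ-pow2*odd p ou = v₂-go-pow2*odd p ou _ ℕ.≤-refl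

  OddInt : ℤ → Set
  OddInt a = Σ ℤ λ c → a ≡ ℤ.1ℤ ℤ.+ + 2 ℤ.* c

  Odd⇒OddInt : ∀ {u} → Odd u → OddInt (+ u)
  Odd⇒OddInt (w , refl) = + w , cong (ℤ._+_ ℤ.1ℤ) (ℤ.pos-* 2 w)

  OddInt-neg : ∀ {a} → OddInt a → OddInt (ℤ.- a)
  OddInt-neg (c , refl) = ℤ.-1ℤ ℤ.- c , negate c
    where
    negate : ∀ c → ℤ.- (ℤ.1ℤ ℤ.+ + 2 ℤ.* c) ≡ ℤ.1ℤ ℤ.+ + 2 ℤ.* (ℤ.-1ℤ ℤ.- c)
    negate = ℤ-Solver.solve-∀

  OddInt-+-2* : ∀ {a} → OddInt a → ∀ c → OddInt (a ℤ.+ + 2 ℤ.* c)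
  OddInt-+-2* (x , refl) c = x ℤ.+ c , regroup x c
    where
    regroup : ∀ x c → ℤ.1ℤ ℤ.+ + 2 ℤ.* x ℤ.+ + 2 ℤ.* c ≡ ℤ.1ℤ ℤ.+ + 2 ℤ.* (x ℤ.+ c)
    regroup = ℤ-Solver.solve-∀

  OddInt-* : ∀ {a b} → OddInt a → OddInt b → OddInt (a ℤ.* b)
  OddInt-* (x , refl) (y , refl) = x ℤ.+ y ℤ.+ + 2 ℤ.* x ℤ.* y , expand x y
    where
    expand : ∀ x y → (ℤ.1ℤ ℤ.+ + 2 ℤ.* x) ℤ.* (ℤ.1ℤ ℤ.+ + 2 ℤ.* y)
                     ≡ ℤ.1ℤ ℤ.+ + 2 ℤ.* (x ℤ.+ y ℤ.+ + 2 ℤ.* x ℤ.* y)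
    expand = ℤ-Solver.solve-∀

  OddInt⇒Odd∣∣ : ∀ {a} → OddInt a → Odd ℤ.∣ a ∣
  OddInt⇒Odd∣∣ (+ k , refl) = k , cong (λ z → ℤ.∣ ℤ.1ℤ ℤ.+ z ∣) (sym (ℤ.pos-* 2 k))
  OddInt⇒Odd∣∣ (-[1+ k ] , refl) = k , (begin
    ℤ.∣ ℤ.1ℤ ℤ.+ + 2 ℤ.* -[1+ k ] ∣          ≡⟨ cong ℤ.∣_∣ (negate (+ k)) ⟩
    ℤ.∣ ℤ.- (ℤ.1ℤ ℤ.+ + 2 ℤ.* + k) ∣         ≡⟨ ℤ.∣-i∣≡∣i∣ (ℤ.1ℤ ℤ.+ + 2 ℤ.* + k) ⟩
    ℤ.∣ ℤ.1ℤ ℤ.+ + 2 ℤ.* + k ∣               ≡⟨ cong (λ z → ℤ.∣ ℤ.1ℤ ℤ.+ z ∣) (ℤ.pos-* 2 k) ⟨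
    suc (2 ℕ.* k)                           ∎)
    where
    open ≡-Reasoning
    negate : ∀ k → ℤ.1ℤ ℤ.+ + 2 ℤ.* (ℤ.- (ℤ.1ℤ ℤ.+ k)) ≡ ℤ.- (ℤ.1ℤ ℤ.+ + 2 ℤ.* k)
    negate = ℤ-Solver.solve-∀

  ℤ-pow2*odd : ∀ {a} → a ≢ ℤ.0ℤ → Σ ℕ λ s → Σ ℤ λ b → OddInt b × a ≡ + (2 ^ s) ℤ.* b
  ℤ-pow2*odd {+ zero} a≢0 = ⊥-elim (a≢0 refl)
  ℤ-pow2*odd {+ suc m} _ with pow2*odd m
  ... | s , u , ou , eq = s , + u , Odd⇒OddInt ou , trans (cong +_ eq) (ℤ.pos-* (2 ^ s) u)
  ℤ-pow2*odd { -[1+ m ]} _ with pow2*odd m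
  ... | s , u , ou , eq = s , ℤ.- + u , OddInt-neg (Odd⇒OddInt ou) ,
    trans (cong (λ k → ℤ.- + k) eq) (trans (cong ℤ.-_ (ℤ.pos-* (2 ^ s) u)) (ℤ.neg-distribʳ-* (+ (2 ^ s)) (+ u)))

  -- Val₂≥ e q presents q as 2^e a / D with D odd, hence v₂ q ≥ e (or q = 0);
  -- Val₂≡ e q asks a to be odd as well, hence v₂ q = e.
  record Val₂≥ (e : ℕ) (q : ℚ) : Set where
    constructor val₂≥
    field
      num     : ℤ
      den     : ℕ
      den-odd : Odd den
      scaled  : q * ℕ→ℚ den ≡ ℕ→ℚ (2 ^ e) * ℤ→ℚ num

  record Val₂≡ (e : ℕ) (q : ℚ) : Set where
    constructor val₂≡
    field
      bound   : Val₂≥ e q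
      num-odd : OddInt (Val₂≥.num bound)

  Val₂≥-0 : ∀ e → Val₂≥ e 0ℚ
  Val₂≥-0 e = val₂≥ (+ 0) 1 (0 , refl) (trans (*-zeroˡ (ℕ→ℚ 1)) (sym (*-zeroʳ (ℕ→ℚ (2 ^ e)))))

  pow2-split : ∀ e k a → ℕ→ℚ (2 ^ (e ℕ.+ k)) * ℤ→ℚ a ≡ ℕ→ℚ (2 ^ e) * ℤ→ℚ (+ (2 ^ k) ℤ.* a)
  pow2-split e k a = begin
    ℕ→ℚ (2 ^ (e ℕ.+ k)) * ℤ→ℚ a                 ≡⟨ cong (λ m → ℕ→ℚ m * ℤ→ℚ a) (ℕ.^-distribˡ-+-* 2 e k) ⟩
    ℕ→ℚ (2 ^ e ℕ.* 2 ^ k) * ℤ→ℚ a               ≡⟨ cong (_* ℤ→ℚ a) (ℕ→ℚ-* (2 ^ e) (2 ^ k)) ⟩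
    ℕ→ℚ (2 ^ e) * ℕ→ℚ (2 ^ k) * ℤ→ℚ a           ≡⟨ *-assoc (ℕ→ℚ (2 ^ e)) _ _ ⟩
    ℕ→ℚ (2 ^ e) * (ℕ→ℚ (2 ^ k) * ℤ→ℚ a)         ≡⟨ cong (ℕ→ℚ (2 ^ e) *_) (ℤ→ℚ-* (+ (2 ^ k)) a) ⟨
    ℕ→ℚ (2 ^ e) * ℤ→ℚ (+ (2 ^ k) ℤ.* a)         ∎
    where open ≡-Reasoning

  Val₂≥-weaken : ∀ {e′ e q} → e′ ℕ.≤ e → Val₂≥ e q → Val₂≥ e′ q
  Val₂≥-weaken {e′} {e} e′≤e (val₂≥ a D oD eq) = val₂≥ (+ (2 ^ (e ℕ.∸ e′)) ℤ.* a) D oD $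
    trans eq (trans (cong (λ m → ℕ→ℚ (2 ^ m) * ℤ→ℚ a) (sym (ℕ.m+[n∸m]≡n e′≤e))) (pow2-split e′ (e ℕ.∸ e′) a))

  scaled-sum : ∀ p q D₁ D₂ P a b → p * ℕ→ℚ D₁ ≡ P * ℤ→ℚ a → q * ℕ→ℚ D₂ ≡ P * ℤ→ℚ b →
               (p + q) * ℕ→ℚ (D₁ ℕ.* D₂) ≡ P * ℤ→ℚ (a ℤ.* + D₂ ℤ.+ b ℤ.* + D₁)
  scaled-sum p q D₁ D₂ P a b eq₁ eq₂ = begin
    (p + q) * ℕ→ℚ (D₁ ℕ.* D₂)                        ≡⟨ cong ((p + q) *_) (ℕ→ℚ-* D₁ D₂) ⟩
    (p + q) * (ℕ→ℚ D₁ * ℕ→ℚ D₂)                      ≡⟨ distrib p q (ℕ→ℚ D₁) (ℕ→ℚ D₂) ⟩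
    p * ℕ→ℚ D₁ * ℕ→ℚ D₂ + q * ℕ→ℚ D₂ * ℕ→ℚ D₁         ≡⟨ cong₂ (λ x y → x * ℕ→ℚ D₂ + y * ℕ→ℚ D₁) eq₁ eq₂ ⟩
    P * ℤ→ℚ a * ℕ→ℚ D₂ + P * ℤ→ℚ b * ℕ→ℚ D₁         ≡⟨ factor P (ℤ→ℚ a) (ℤ→ℚ b) (ℕ→ℚ D₁) (ℕ→ℚ D₂) ⟩
    P * (ℤ→ℚ a * ℕ→ℚ D₂ + ℤ→ℚ b * ℕ→ℚ D₁)           ≡⟨ cong (P *_) (cong₂ _+_ (ℤ→ℚ-* a (+ D₂)) (ℤ→ℚ-* b (+ D₁))) ⟨
    P * (ℤ→ℚ (a ℤ.* + D₂) + ℤ→ℚ (b ℤ.* + D₁))       ≡⟨ cong (P *_) (ℤ→ℚ-+ (a ℤ.* + D₂) (b ℤ.* + D₁)) ⟨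
    P * ℤ→ℚ (a ℤ.* + D₂ ℤ.+ b ℤ.* + D₁)             ∎
    where
    open ≡-Reasoning
    distrib : ∀ p q x y → (p + q) * (x * y) ≡ p * x * y + q * y * x
    distrib = solve-∀ ℚ-ring
    factor : ∀ P a b x y → P * a * y + P * b * x ≡ P * (a * y + b * x)
    factor = solve-∀ ℚ-ring

  Val₂≥-+ : ∀ {e p q} → Val₂≥ e p → Val₂≥ e q → Val₂≥ e (p + q)
  Val₂≥-+ {e} {p} {q} (val₂≥ a D₁ o₁ eq₁) (val₂≥ b D₂ o₂ eq₂) =
    val₂≥ (a ℤ.* + D₂ ℤ.+ b ℤ.* + D₁) (D₁ ℕ.* D₂) (Odd-* o₁ o₂) $ scaled-sum p q D₁ D₂ (ℕ→ℚ (2 ^ e)) a b eq₁ eq₂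

  Val₂≡-+ : ∀ {e p q} → Val₂≡ e p → Val₂≥ (suc e) q → Val₂≡ e (p + q)
  Val₂≡-+ {e} {p} {q} (val₂≡ (val₂≥ a D₁ o₁ eq₁) oa) (val₂≥ b D₂ o₂ eq₂) = val₂≡
    (val₂≥ (a ℤ.* + D₂ ℤ.+ + 2 ℤ.* b ℤ.* + D₁) (D₁ ℕ.* D₂) (Odd-* o₁ o₂)
      (scaled-sum p q D₁ D₂ (ℕ→ℚ (2 ^ e)) a (+ 2 ℤ.* b) eq₁ eq₂′))
    $ subst OddInt (cong (ℤ._+_ (a ℤ.* + D₂)) (sym (ℤ.*-assoc (+ 2) b (+ D₁))))
      (OddInt-+-2* (OddInt-* oa (Odd⇒OddInt o₂)) (b ℤ.* + D₁))
    where
    eq₂′ : q * ℕ→ℚ D₂ ≡ ℕ→ℚ (2 ^ e) * ℤ→ℚ (+ 2 ℤ.* b)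
    eq₂′ = trans eq₂ (trans (cong (λ m → ℕ→ℚ (2 ^ m) * ℤ→ℚ b) (ℕ.+-comm 1 e)) (pow2-split e 1 b))

  cross-multiply : ∀ q D A → q * ℕ→ℚ D ≡ ℤ→ℚ A → ↥ q ℤ.* + D ≡ A ℤ.* ↧ q
  cross-multiply q@(mkℚ N d _) D A eq with unnormalised
    where
    open ℚᵘ.≃-Reasoning
    unnormalised : ℚᵘ.mkℚᵘ N d ℚᵘ.* ℚᵘ.mkℚᵘ (+ D) 0 ℚᵘ.≃ ℚᵘ.mkℚᵘ A 0
    unnormalised = begin
      ℚᵘ.mkℚᵘ N d ℚᵘ.* ℚᵘ.mkℚᵘ (+ D) 0  ≈⟨ ℚᵘ.*-congˡ {toℚᵘ q} (toℚᵘ-ℤ→ℚ (+ D)) ⟨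
      toℚᵘ q ℚᵘ.* toℚᵘ (ℕ→ℚ D)          ≈⟨ toℚᵘ-homo-* q (ℕ→ℚ D) ⟨
      toℚᵘ (q * ℕ→ℚ D)                  ≡⟨ cong toℚᵘ eq ⟩
      toℚᵘ (ℤ→ℚ A)                      ≈⟨ toℚᵘ-ℤ→ℚ A ⟩
      ℚᵘ.mkℚᵘ A 0                       ∎
  ... | ℚᵘ.*≡* e = trans (sym (ℤ.*-identityʳ _)) (trans e (cong (λ k → A ℤ.* + suc k) (ℕ.*-identityʳ d)))

  cross-multiply-∣∣ : ∀ e q D a → q * ℕ→ℚ D ≡ ℕ→ℚ (2 ^ e) * ℤ→ℚ a →
                      ℤ.∣ ↥ q ∣ ℕ.* D ≡ 2 ^ e ℕ.* ℤ.∣ a ∣ ℕ.* ↧ₙ q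
  cross-multiply-∣∣ e q D a eq = begin
    ℤ.∣ ↥ q ∣ ℕ.* D                         ≡⟨ ℤ.abs-* (↥ q) (+ D) ⟨
    ℤ.∣ ↥ q ℤ.* + D ∣                       ≡⟨ cong ℤ.∣_∣ (cross-multiply q D A (trans eq (sym (ℤ→ℚ-* (+ (2 ^ e)) a)))) ⟩
    ℤ.∣ A ℤ.* ↧ q ∣                         ≡⟨ ℤ.abs-* A (↧ q) ⟩
    ℤ.∣ A ∣ ℕ.* ↧ₙ q                        ≡⟨ cong (ℕ._* ↧ₙ q) (ℤ.abs-* (+ (2 ^ e)) a) ⟩
    2 ^ e ℕ.* ℤ.∣ a ∣ ℕ.* ↧ₙ q              ∎
    where
    open ≡-Reasoning
    A : ℤ
    A = + (2 ^ e) ℤ.* a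

  Val₂≡⇒≢0 : ∀ {e q} → Val₂≡ e q → q ≢ 0ℚ
  Val₂≡⇒≢0 {e} (val₂≡ (val₂≥ a D _ eq) oa) refl = ℕ.<⇒≢ positive (cross-multiply-∣∣ e 0ℚ D a eq)
    where
    positive : 0 ℕ.< 2 ^ e ℕ.* ℤ.∣ a ∣ ℕ.* 1
    positive = ℕ.*-mono-≤ (ℕ.*-mono-≤ (ℕ.m^n>0 2 e) (Odd⇒>0 (OddInt⇒Odd∣∣ oa))) ℕ.z<s

  pow2*odd-v₂ℕ : ∀ {m} → 0 ℕ.< m → Σ ℕ λ p → Σ ℕ λ u → Odd u × m ≡ 2 ^ p ℕ.* u × v₂ℕ m ≡ p
  pow2*odd-v₂ℕ {suc m} _ with pow2*odd m
  ... | p , u , ou , eq = p , u , ou , eq , trans (cong v₂ℕ eq) (v₂ℕ-pow2*odd p ou)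

  Val₂≡⇒v₂≡ : ∀ {e q} → Val₂≡ e q → v₂ q ≡ + e
  Val₂≡⇒v₂≡ {e} {q} exact@(val₂≡ (val₂≥ a D oD eq) oa)
    with pow2*odd-v₂ℕ {ℤ.∣ ↥ q ∣} ∣↥q∣>0 | pow2*odd-v₂ℕ {↧ₙ q} ℕ.z<s
    where
    ∣↥q∣>0 : 0 ℕ.< ℤ.∣ ↥ q ∣
    ∣↥q∣>0 = ℕ.n≢0⇒n>0 λ ∣↥q∣≡0 → Val₂≡⇒≢0 exact (↥p≡0⇒p≡0 q (ℤ.∣i∣≡0⇒i≡0 ∣↥q∣≡0))
  ... | p , u , ou , ∣↥q∣≡ , v₂↥q≡p | δ , o , oo , ↧q≡ , v₂↧q≡δ = begin
    + v₂ℕ ℤ.∣ ↥ q ∣ ℤ.- + v₂ℕ (↧ₙ q)   ≡⟨ cong₂ (λ x y → + x ℤ.- + y) (trans v₂↥q≡p p≡e+δ) v₂↧q≡δ ⟩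
    + (e ℕ.+ δ) ℤ.- + δ               ≡⟨ cong (ℤ._- + δ) (ℤ.pos-+ e δ) ⟩
    + e ℤ.+ + δ ℤ.- + δ               ≡⟨ cancel (+ e) (+ δ) ⟩
    + e                               ∎
    where
    open ≡-Reasoning
    cancel : ∀ x y → x ℤ.+ y ℤ.- y ≡ x
    cancel = ℤ-Solver.solve-∀
    p≡e+δ : p ≡ e ℕ.+ δ
    p≡e+δ = pow2*odd-injective (Odd-* ou oD) (Odd-* (OddInt⇒Odd∣∣ oa) oo) (begin
      2 ^ p ℕ.* (u ℕ.* D)                           ≡⟨ ℕ.*-assoc (2 ^ p) u D ⟨
      2 ^ p ℕ.* u ℕ.* D                             ≡⟨ cong (ℕ._* D) ∣↥q∣≡ ⟨
      ℤ.∣ ↥ q ∣ ℕ.* D                               ≡⟨ cross-multiply-∣∣ e q D a eq ⟩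
      2 ^ e ℕ.* ℤ.∣ a ∣ ℕ.* ↧ₙ q                    ≡⟨ cong (2 ^ e ℕ.* ℤ.∣ a ∣ ℕ.*_) ↧q≡ ⟩
      2 ^ e ℕ.* ℤ.∣ a ∣ ℕ.* (2 ^ δ ℕ.* o)           ≡⟨ regroup (2 ^ e) (2 ^ δ) ℤ.∣ a ∣ o ⟩
      2 ^ e ℕ.* 2 ^ δ ℕ.* (ℤ.∣ a ∣ ℕ.* o)           ≡⟨ cong (ℕ._* (ℤ.∣ a ∣ ℕ.* o)) (ℕ.^-distribˡ-+-* 2 e δ) ⟨
      2 ^ (e ℕ.+ δ) ℕ.* (ℤ.∣ a ∣ ℕ.* o)             ∎)
      where
      regroup : ∀ E Δ x y → E ℕ.* x ℕ.* (Δ ℕ.* y) ≡ E ℕ.* Δ ℕ.* (x ℕ.* y)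
      regroup = ℕ-Solver.solve-∀

  Val₂≥⇒Val₂≡ : ∀ {e q} → Val₂≥ e q → q ≢ 0ℚ → Σ ℕ λ s → Val₂≡ (e ℕ.+ s) q
  Val₂≥⇒Val₂≡ {e} {q} (val₂≥ a D oD eq) q≢0 with a ℤ.≟ ℤ.0ℤ
  ... | yes refl = ⊥-elim (q≢0 (↥p≡0⇒p≡0 q (ℤ.∣i∣≡0⇒i≡0 ∣↥q∣≡0)))
    where
    ∣↥q∣≡0 : ℤ.∣ ↥ q ∣ ≡ 0
    ∣↥q∣≡0 = ℕ.m*n≡0⇒m≡0 _ D {{ℕ.>-nonZero (Odd⇒>0 oD)}}
               (trans (cross-multiply-∣∣ e q D (+ 0) eq) (cong (ℕ._* ↧ₙ q) (ℕ.*-zeroʳ (2 ^ e))))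
  ... | no a≢0 with ℤ-pow2*odd a≢0
  ...   | s , b , ob , refl = s , val₂≡ (val₂≥ b D oD (trans eq (sym (pow2-split e s b)))) ob

  Val₂≥⇒v₂≥ : ∀ {e q} → Val₂≥ e q → q ≢ 0ℚ → + e ℤ.≤ v₂ q
  Val₂≥⇒v₂≥ w q≢0 with Val₂≥⇒Val₂≡ w q≢0
  ... | s , exact = subst (+ _ ℤ.≤_) (sym (Val₂≡⇒v₂≡ exact)) (ℤ.+≤+ (ℕ.m≤m+n _ s))

  Val₂≥∃ : (ℕ → Set) → ℚ → Set
  Val₂≥∃ P q = Σ ℕ λ e → P e × Val₂≥ e q

  Val₂≥∃-+ : ∀ {P p q} → Val₂≥∃ P p → Val₂≥∃ P q → Val₂≥∃ P (p + q)
  Val₂≥∃-+ (e₁ , P₁ , p≥) (e₂ , P₂ , q≥) with ℕ.≤-total e₁ e₂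
  ... | inj₁ e₁≤e₂ = e₁ , P₁ , Val₂≥-+ p≥ (Val₂≥-weaken e₁≤e₂ q≥)
  ... | inj₂ e₂≤e₁ = e₂ , P₂ , Val₂≥-+ (Val₂≥-weaken e₂≤e₁ p≥) q≥

module CoefficientsOfK where

  open import Data.Integer as ℤ using (ℤ; +_)
  import Data.Integer.Properties as ℤ
  import Data.Integer.Tactic.RingSolver as ℤ-Solver
  open import Data.Nat as ℕ using (ℕ; zero; suc; _^_; _!; _∸_)
  import Data.Nat.Properties as ℕ
  open import Data.Nat.Combinatorics using (_C_)
  open import Data.Rational using (ℚ; _+_; _*_; _-_; -_; _/_; 0ℚ; 1ℚ; toℚᵘ)
  open import Data.Rational.Properties
  import Data.Rational.Unnormalised as ℚᵘ
  import Data.Rational.Unnormalised.Properties as ℚᵘ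
  open import Data.Product using (Σ; _×_; _,_)
  open import Data.Sum using (inj₁; inj₂)
  open import Data.Empty using (⊥-elim)
  open import Relation.Binary.Definitions using (tri<; tri≈; tri>)
  open import Relation.Binary.PropositionalEquality
  open import Tactic.RingSolver using (solve-∀)
  open import Defs using (ℕ→ℚ; ℤ→ℚ; _^ℚ_; binomPoly; Kterm; Ksum; K)
  open BinaryDigits
  open RationalCasts
  open TwoAdicValuation

  stirling₁ : ℕ → ℕ → ℤ
  stirling₁ zero    zero    = ℤ.1ℤ
  stirling₁ zero    (suc i) = ℤ.0ℤ
  stirling₁ (suc j) zero    = ℤ.0ℤ ℤ.- + j ℤ.* stirling₁ j zero
  stirling₁ (suc j) (suc i) = stirling₁ j i ℤ.- + j ℤ.* stirling₁ j (suc i)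

  stirling₁-above : ∀ {j i} → j ℕ.< i → stirling₁ j i ≡ ℤ.0ℤ
  stirling₁-above {zero} {suc i} _ = refl
  stirling₁-above {suc j} {suc i} (ℕ.s≤s j<i)
    rewrite stirling₁-above j<i | stirling₁-above (ℕ.m<n⇒m<1+n j<i) = vanish (+ j)
    where
    vanish : ∀ x → ℤ.0ℤ ℤ.- x ℤ.* ℤ.0ℤ ≡ ℤ.0ℤ
    vanish = ℤ-Solver.solve-∀

  stirling₁-diag : ∀ j → stirling₁ j j ≡ ℤ.1ℤ
  stirling₁-diag zero = refl
  stirling₁-diag (suc j) rewrite stirling₁-diag j | stirling₁-above (ℕ.n<1+n j) = vanish (+ j)
    where
    vanish : ∀ x → ℤ.1ℤ ℤ.- x ℤ.* ℤ.0ℤ ≡ ℤ.1ℤ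
    vanish = ℤ-Solver.solve-∀

  1/[1+m]*[1+m]≡1 : ∀ m → (+ 1 / suc m) * ℕ→ℚ (suc m) ≡ 1ℚ
  1/[1+m]*[1+m]≡1 m = toℚᵘ-injective (begin
    toℚᵘ ((+ 1 / suc m) * ℕ→ℚ (suc m))           ≈⟨ toℚᵘ-homo-* (+ 1 / suc m) (ℕ→ℚ (suc m)) ⟩
    toℚᵘ (+ 1 / suc m) ℚᵘ.* toℚᵘ (ℕ→ℚ (suc m))   ≈⟨ ℚᵘ.*-cong (toℚᵘ-fromℚᵘ (ℚᵘ.mkℚᵘ (+ 1) m)) (toℚᵘ-ℤ→ℚ (+ suc m)) ⟩
    ℚᵘ.mkℚᵘ (+ 1) m ℚᵘ.* ℚᵘ.mkℚᵘ (+ suc m) 0    ≈⟨ ℚᵘ.*≡* (trans (ℤ.*-identityʳ _) (trans (ℤ.*-identityˡ _)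
      (trans (cong (λ k → + suc k) (sym (ℕ.*-identityʳ m))) (sym (ℤ.*-identityˡ _))))) ⟩
    ℚᵘ.1ℚᵘ                                     ∎)
    where open ℚᵘ.≃-Reasoning

  binomPoly-recurrence : ∀ j S P cs cp → S * ℕ→ℚ (j !) ≡ ℤ→ℚ cs → P * ℕ→ℚ (j !) ≡ ℤ→ℚ cp →
    (+ 1 / suc j) * (S - ℕ→ℚ j * P) * ℕ→ℚ (suc j ℕ.* j !) ≡ ℤ→ℚ (cs ℤ.- + j ℤ.* cp)
  binomPoly-recurrence j S P cs cp S≡ P≡ = begin
    (+ 1 / suc j) * (S - jℚ * P) * ℕ→ℚ (suc j ℕ.* j !)       ≡⟨ cong ((+ 1 / suc j) * (S - jℚ * P) *_) (ℕ→ℚ-* (suc j) (j !)) ⟩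
    (+ 1 / suc j) * (S - jℚ * P) * (ℕ→ℚ (suc j) * F)         ≡⟨ regroup (+ 1 / suc j) S jℚ P (ℕ→ℚ (suc j)) F ⟩
    (+ 1 / suc j) * ℕ→ℚ (suc j) * (S * F - jℚ * (P * F))     ≡⟨ cong₂ (λ u v → u * (v - jℚ * (P * F))) (1/[1+m]*[1+m]≡1 j) S≡ ⟩
    1ℚ * (ℤ→ℚ cs - jℚ * (P * F))                             ≡⟨ cong (λ v → 1ℚ * (ℤ→ℚ cs - jℚ * v)) P≡ ⟩
    1ℚ * (ℤ→ℚ cs - jℚ * ℤ→ℚ cp)                              ≡⟨ *-identityˡ (ℤ→ℚ cs - jℚ * ℤ→ℚ cp) ⟩
    ℤ→ℚ cs - jℚ * ℤ→ℚ cp                                     ≡⟨ cong (_-_ (ℤ→ℚ cs)) (ℤ→ℚ-* (+ j) cp) ⟨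
    ℤ→ℚ cs - ℤ→ℚ (+ j ℤ.* cp)                               ≡⟨ ℤ→ℚ-- cs (+ j ℤ.* cp) ⟨
    ℤ→ℚ (cs ℤ.- + j ℤ.* cp)                                 ∎
    where
    open ≡-Reasoning
    jℚ F : ℚ
    jℚ = ℕ→ℚ j
    F = ℕ→ℚ (j !)
    regroup : ∀ u S x P v F → u * (S - x * P) * (v * F) ≡ u * v * (S * F - x * (P * F))
    regroup = solve-∀ ℚ-ring

  binomPoly-coeff : ∀ j i → binomPoly j i * ℕ→ℚ (j !) ≡ ℤ→ℚ (stirling₁ j i)
  binomPoly-coeff zero    zero    = refl
  binomPoly-coeff zero    (suc i) = refl
  binomPoly-coeff (suc j) zero    =
    binomPoly-recurrence j 0ℚ (binomPoly j zero) ℤ.0ℤ (stirling₁ j zero) (*-zeroˡ (ℕ→ℚ (j !))) (binomPoly-coeff j zero)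
  binomPoly-coeff (suc j) (suc i) =
    binomPoly-recurrence j (binomPoly j i) (binomPoly j (suc i)) (stirling₁ j i) (stirling₁ j (suc i))
      (binomPoly-coeff j i) (binomPoly-coeff j (suc i))

  binomPoly-above : ∀ {j i} → j ℕ.< i → binomPoly j i ≡ 0ℚ
  binomPoly-above {j} {i} j<i = *-cancelʳ-≡-pos (ℕ→ℚ (j !)) (ℕ→ℚ-mono-< (ℕ.>-nonZero⁻¹ (j !) {{j ℕ.!≢0}}))
    (trans (binomPoly-coeff j i) (trans (cong ℤ→ℚ (stirling₁-above j<i)) (sym (*-zeroˡ (ℕ→ℚ (j !))))))

  Kterm-vanishes : ∀ n t {j i} → j ℕ.< i → Kterm n t j i ≡ 0ℚ
  Kterm-vanishes n t {j} j<i = trans (cong (weight *_) (binomPoly-above j<i)) (*-zeroʳ weight)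
    where
    weight : ℚ
    weight = (- ℕ→ℚ 2) ^ℚ j * ℕ→ℚ ((t ∸ j) C (n ∸ j))

  [-2]^j≡ : ∀ j → (- ℕ→ℚ 2) ^ℚ j ≡ ℤ→ℚ (ℤ.-1ℤ ℤ.^ j) * ℕ→ℚ (2 ^ j)
  [-2]^j≡ zero    = refl
  [-2]^j≡ (suc j) = begin
    (- ℕ→ℚ 2) * (- ℕ→ℚ 2) ^ℚ j                              ≡⟨ cong ((- ℕ→ℚ 2) *_) ([-2]^j≡ j) ⟩
    (- ℕ→ℚ 2) * (ℤ→ℚ (ℤ.-1ℤ ℤ.^ j) * ℕ→ℚ (2 ^ j))           ≡⟨ swap-sign (ℕ→ℚ 2) (ℤ→ℚ (ℤ.-1ℤ ℤ.^ j)) (ℕ→ℚ (2 ^ j)) ⟩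
    (- ℤ→ℚ (ℤ.-1ℤ ℤ.^ j)) * (ℕ→ℚ 2 * ℕ→ℚ (2 ^ j))          ≡⟨ cong₂ _*_ (sym (ℤ→ℚ-neg (ℤ.-1ℤ ℤ.^ j))) (sym (ℕ→ℚ-* 2 (2 ^ j))) ⟩
    ℤ→ℚ (ℤ.- (ℤ.-1ℤ ℤ.^ j)) * ℕ→ℚ (2 ℕ.* 2 ^ j)            ≡⟨ cong (λ a → ℤ→ℚ a * ℕ→ℚ (2 ℕ.* 2 ^ j)) (ℤ.-1*i≡-i (ℤ.-1ℤ ℤ.^ j)) ⟨
    ℤ→ℚ (ℤ.-1ℤ ℤ.* ℤ.-1ℤ ℤ.^ j) * ℕ→ℚ (2 ℕ.* 2 ^ j)        ∎
    where
    open ≡-Reasoning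
    swap-sign : ∀ t s p → (- t) * (s * p) ≡ (- s) * (t * p)
    swap-sign = solve-∀ ℚ-ring

  OddInt-[-1]^ : ∀ j → OddInt (ℤ.-1ℤ ℤ.^ j)
  OddInt-[-1]^ zero    = ℤ.0ℤ , refl
  OddInt-[-1]^ (suc j) = OddInt-* (ℤ.-1ℤ , refl) (OddInt-[-1]^ j)

  -- (−2)^j / j! = ±2^{s₂ j} / o with o odd, by Legendre's formula.
  Kterm-scaled : ∀ n t j i → Σ ℕ λ o → Odd o ×
    Kterm n t j i * ℕ→ℚ o ≡ ℕ→ℚ (2 ^ s₂ j) * ℤ→ℚ (ℤ.-1ℤ ℤ.^ j ℤ.* + ((t ∸ j) C (n ∸ j)) ℤ.* stirling₁ j i)
  Kterm-scaled n t j i with legendre j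
  ... | w , o , oo , j!≡ , w+s₂j≡j = o , oo , *-cancelʳ-≡-pos W (ℕ→ℚ-mono-< (ℕ.m^n>0 2 w)) (begin
    Kt * ℕ→ℚ o * W                                      ≡⟨ *-assoc Kt _ _ ⟩
    Kt * (ℕ→ℚ o * W)                                    ≡⟨ cong (Kt *_) (trans (*-comm (ℕ→ℚ o) W) (sym (ℕ→ℚ-* (2 ^ w) o))) ⟩
    Kt * ℕ→ℚ (2 ^ w ℕ.* o)                              ≡⟨ cong (λ m → Kt * ℕ→ℚ m) j!≡ ⟨
    Kt * ℕ→ℚ (j !)                                      ≡⟨ *-assoc ((- ℕ→ℚ 2) ^ℚ j * Bq) (binomPoly j i) _ ⟩
    (- ℕ→ℚ 2) ^ℚ j * Bq * (binomPoly j i * ℕ→ℚ (j !))   ≡⟨ cong₂ (λ x y → x * Bq * y) ([-2]^j≡ j) (binomPoly-coeff j i) ⟩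
    ℤ→ℚ σ * ℕ→ℚ (2 ^ j) * Bq * ℤ→ℚ st                   ≡⟨ cong (λ x → ℤ→ℚ σ * x * Bq * ℤ→ℚ st) 2^j≡W*S ⟩
    ℤ→ℚ σ * (W * S) * Bq * ℤ→ℚ st                       ≡⟨ regroup (ℤ→ℚ σ) W S Bq (ℤ→ℚ st) ⟩
    S * (ℤ→ℚ σ * Bq * ℤ→ℚ st) * W                       ≡⟨ cong (λ x → S * x * W) (sym integral) ⟩
    S * ℤ→ℚ (σ ℤ.* + B ℤ.* st) * W                      ∎)
    where
    open ≡-Reasoning
    B : ℕ
    B = (t ∸ j) C (n ∸ j)
    σ st : ℤ
    σ = ℤ.-1ℤ ℤ.^ j
    st = stirling₁ j i
    Bq Kt W S : ℚ
    Bq = ℕ→ℚ B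
    Kt = Kterm n t j i
    W = ℕ→ℚ (2 ^ w)
    S = ℕ→ℚ (2 ^ s₂ j)
    2^j≡W*S : ℕ→ℚ (2 ^ j) ≡ W * S
    2^j≡W*S = trans (cong (λ k → ℕ→ℚ (2 ^ k)) (sym w+s₂j≡j))
      (trans (cong ℕ→ℚ (ℕ.^-distribˡ-+-* 2 w (s₂ j))) (ℕ→ℚ-* (2 ^ w) (2 ^ s₂ j)))
    integral : ℤ→ℚ (σ ℤ.* + B ℤ.* st) ≡ ℤ→ℚ σ * Bq * ℤ→ℚ st
    integral = trans (ℤ→ℚ-* (σ ℤ.* + B) st) (cong (_* ℤ→ℚ st) (ℤ→ℚ-* σ (+ B)))
    regroup : ∀ s w p c x → s * (w * p) * c * x ≡ p * (s * c * x) * w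
    regroup = solve-∀ ℚ-ring

  Kterm-Val₂≥ : ∀ n t j i → Val₂≥ (s₂ j) (Kterm n t j i)
  Kterm-Val₂≥ n t j i = let o , oo , eq = Kterm-scaled n t j i in
    val₂≥ (ℤ.-1ℤ ℤ.^ j ℤ.* + ((t ∸ j) C (n ∸ j)) ℤ.* stirling₁ j i) o oo eq

  Kterm-Val₂≡ : ∀ n t i → Odd ((t ∸ i) C (n ∸ i)) → Val₂≡ (s₂ i) (Kterm n t i i)
  Kterm-Val₂≡ n t i oC = let o , oo , eq = Kterm-scaled n t i i in
    val₂≡ (val₂≥ (σB ℤ.* stirling₁ i i) o oo eq)
    (subst OddInt (cong (σB ℤ.*_) (sym (stirling₁-diag i)))
      (OddInt-* (OddInt-* (OddInt-[-1]^ i) (Odd⇒OddInt oC)) (ℤ.0ℤ , refl)))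
    where
    σB : ℤ
    σB = ℤ.-1ℤ ℤ.^ i ℤ.* + ((t ∸ i) C (n ∸ i))

  partialSum : (ℕ → ℚ) → ℕ → ℚ
  partialSum f zero    = f zero
  partialSum f (suc m) = partialSum f m + f (suc m)

  Ksum≡partialSum : ∀ n t m i → Ksum n t m i ≡ partialSum (λ j → Kterm n t j i) m
  Ksum≡partialSum n t zero    i = refl
  Ksum≡partialSum n t (suc m) i = cong (_+ Kterm n t (suc m) i) (Ksum≡partialSum n t m i)

  partialSum-closed : ∀ (P : ℚ → Set) → (∀ {p q} → P p → P q → P (p + q)) →
                      ∀ {f} m → (∀ j → j ℕ.≤ m → P (f j)) → P (partialSum f m)
  partialSum-closed P P-+ zero    Pf = Pf zero ℕ.z≤n
  partialSum-closed P P-+ (suc m) Pf =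
    P-+ (partialSum-closed P P-+ m λ j j≤m → Pf j (ℕ.m≤n⇒m≤1+n j≤m)) (Pf (suc m) ℕ.≤-refl)

  partialSum-Val₂≡ : ∀ {e f i} m → i ℕ.≤ m → Val₂≡ e (f i) →
                     (∀ j → j ℕ.≤ m → j ≢ i → Val₂≥ (suc e) (f j)) → Val₂≡ e (partialSum f m)
  partialSum-Val₂≡ zero ℕ.z≤n fi others = fi
  partialSum-Val₂≡ {e} {f} {i} (suc m) i≤1+m fi others with ℕ.m≤n⇒m<n∨m≡n i≤1+m
  ... | inj₁ (ℕ.s≤s i≤m) = Val₂≡-+ (partialSum-Val₂≡ m i≤m fi λ j j≤m → others j (ℕ.m≤n⇒m≤1+n j≤m))
                                     (others (suc m) ℕ.≤-refl (ℕ.>⇒≢ (ℕ.s≤s i≤m)))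
  ... | inj₂ refl = subst (Val₂≡ e) (+-comm (f (suc m)) (partialSum f m)) (Val₂≡-+ fi lower)
    where
    lower : Val₂≥ (suc e) (partialSum f m)
    lower = partialSum-closed (Val₂≥ (suc e)) Val₂≥-+ m λ j j≤m → others j (ℕ.m≤n⇒m≤1+n j≤m) (ℕ.<⇒≢ (ℕ.s≤s j≤m))

  K-vertex : ∀ n t c w → 2 ^ c ℕ.* w ℕ.≤ n → n ℕ.< 2 ^ c ℕ.* suc w →
             Odd ((t ∸ 2 ^ c ℕ.* w) C (n ∸ 2 ^ c ℕ.* w)) → Val₂≡ (s₂ w) (K n t (2 ^ c ℕ.* w))
  K-vertex n t c w i≤n n<bound oB =
    subst (Val₂≡ (s₂ w)) (sym (Ksum≡partialSum n t n i)) (partialSum-Val₂≡ n i≤n diagonal others)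
    where
    i : ℕ
    i = 2 ^ c ℕ.* w
    diagonal : Val₂≡ (s₂ w) (Kterm n t i i)
    diagonal = subst (λ e → Val₂≡ e (Kterm n t i i)) (s₂-2^* c w) (Kterm-Val₂≡ n t i oB)
    s₂-jump : ∀ {j} → j ℕ.≤ n → i ℕ.< j → suc (s₂ w) ℕ.≤ s₂ j
    s₂-jump {j} j≤n i<j = ℕ.+-cancelʳ-< w (s₂ w) (s₂ j) (ℕ.*-cancelˡ-< (2 ^ c) _ _ (ℕ.<-≤-trans
      (subst (ℕ._< 2 ^ c ℕ.* s₂ w ℕ.+ j) (sym (ℕ.*-distribˡ-+ (2 ^ c) (s₂ w) w)) (ℕ.+-monoʳ-< (2 ^ c ℕ.* s₂ w) i<j))
      (s₂-above-line c (ℕ.≤-<-trans j≤n n<bound))))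
    others : ∀ j → j ℕ.≤ n → j ≢ i → Val₂≥ (suc (s₂ w)) (Kterm n t j i)
    others j j≤n j≢i with ℕ.<-cmp j i
    ... | tri< j<i _ _ = subst (Val₂≥ (suc (s₂ w))) (sym (Kterm-vanishes n t j<i)) (Val₂≥-0 (suc (s₂ w)))
    ... | tri≈ _ j≡i _ = ⊥-elim (j≢i j≡i)
    ... | tri> _ _ i<j = Val₂≥-weaken (s₂-jump j≤n i<j) (Kterm-Val₂≥ n t j i)

  K-above-line : ∀ n t b h {i} → n ℕ.< 2 ^ b ℕ.* suc h → i ℕ.≤ n →
                 Val₂≥∃ (λ e → 2 ^ b ℕ.* s₂ h ℕ.+ i ℕ.≤ 2 ^ b ℕ.* (e ℕ.+ h)) (K n t i)
  K-above-line n t b h {i} n<bound i≤n =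
    subst (Val₂≥∃ AboveLine) (sym (Ksum≡partialSum n t n i))
      (partialSum-closed (Val₂≥∃ AboveLine) Val₂≥∃-+ n term)
    where
    AboveLine : ℕ → Set
    AboveLine e = 2 ^ b ℕ.* s₂ h ℕ.+ i ℕ.≤ 2 ^ b ℕ.* (e ℕ.+ h)
    term : ∀ j → j ℕ.≤ n → Val₂≥∃ AboveLine (Kterm n t j i)
    term j j≤n with ℕ.<-cmp j i
    ... | tri< j<i _ _ = s₂ i , s₂-above-line b (ℕ.≤-<-trans i≤n n<bound) ,
                         subst (Val₂≥ (s₂ i)) (sym (Kterm-vanishes n t j<i)) (Val₂≥-0 (s₂ i))
    ... | tri≈ _ refl _ = s₂ j , s₂-above-line b (ℕ.≤-<-trans j≤n n<bound) , Kterm-Val₂≥ n t j i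
    ... | tri> _ _ i<j = s₂ j ,
          ℕ.≤-trans (ℕ.+-monoʳ-≤ _ (ℕ.<⇒≤ i<j)) (s₂-above-line b (ℕ.≤-<-trans j≤n n<bound)) , Kterm-Val₂≥ n t j i

module Profile where

  open import Data.Nat as ℕ using (ℕ; zero; suc)
  import Data.Nat.Properties as ℕ
  open import Data.Nat.Divisibility using (_∣_; ∣m∣n⇒∣m+n)
  open import Data.Rational using (ℚ; _+_; _*_; _-_; -_; _≤_; 0ℚ; 1ℚ; ½; _⊓_; _⊔_; nonNegative)
  open import Data.Rational.Properties
  open import Data.List using ([]; _∷_; map; length)
  open import Data.List.Relation.Unary.Linked using (Linked; _∷_)
  open import Data.Nat.ListAction using (sum)
  open import Data.Product using (_,_)
  open import Data.Sum using (inj₁; inj₂)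
  open import Relation.Binary.PropositionalEquality
  open import Tactic.RingSolver using (solve-∀)
  open import Defs using (ℕ→ℚ; _^ℚ_; pow2; clamp01; profile)
  open BinaryDigits
  open RationalCasts

  ½^j*2^j≡1 : ∀ j → ½ ^ℚ j * ℕ→ℚ (pow2 j) ≡ 1ℚ
  ½^j*2^j≡1 zero    = refl
  ½^j*2^j≡1 (suc j) = begin
    ½ * ½ ^ℚ j * ℕ→ℚ (2 ℕ.* pow2 j)          ≡⟨ cong (½ * ½ ^ℚ j *_) (ℕ→ℚ-* 2 (pow2 j)) ⟩
    ½ * ½ ^ℚ j * (ℕ→ℚ 2 * ℕ→ℚ (pow2 j))      ≡⟨ interchange ½ (½ ^ℚ j) (ℕ→ℚ 2) (ℕ→ℚ (pow2 j)) ⟩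
    ½ * ℕ→ℚ 2 * (½ ^ℚ j * ℕ→ℚ (pow2 j))      ≡⟨ cong (½ * ℕ→ℚ 2 *_) (½^j*2^j≡1 j) ⟩
    1ℚ                                       ∎
    where
    open ≡-Reasoning
    interchange : ∀ a b c d → a * b * (c * d) ≡ a * c * (b * d)
    interchange = solve-∀ ℚ-ring

  0≤1 : 0ℚ ≤ 1ℚ
  0≤1 = ℕ→ℚ-mono-≤ {0} {1} ℕ.z≤n

  0≤½^j : ∀ j → 0ℚ ≤ ½ ^ℚ j
  0≤½^j zero    = 0≤1
  0≤½^j (suc j) = nonNegative⁻¹ _ {{nonNeg*nonNeg⇒nonNeg ½ (½ ^ℚ j) {{nonNegative (0≤½^j j)}}}}

  0≤2^j : ∀ j → 0ℚ ≤ ℕ→ℚ (pow2 j)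
  0≤2^j j = ℕ→ℚ-mono-≤ {0} {pow2 j} ℕ.z≤n

  clamp01-≤0 : ∀ {q} → q ≤ 0ℚ → clamp01 q ≡ 0ℚ
  clamp01-≤0 q≤0 = trans (cong (1ℚ ⊓_) (p≥q⇒p⊔q≡p q≤0)) (p≥q⇒p⊓q≡q 0≤1)

  clamp01-≥1 : ∀ {q} → 1ℚ ≤ q → clamp01 q ≡ 1ℚ
  clamp01-≥1 1≤q = trans (cong (1ℚ ⊓_) (p≤q⇒p⊔q≡q (≤-trans 0≤1 1≤q))) (p≤q⇒p⊓q≡p 1≤q)

  clamp01-[0,1] : ∀ {q} → 0ℚ ≤ q → q ≤ 1ℚ → clamp01 q ≡ q
  clamp01-[0,1] 0≤q q≤1 = trans (cong (1ℚ ⊓_) (p≤q⇒p⊔q≡q 0≤q)) (p≥q⇒p⊓q≡q q≤1)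

  module _ (j : ℕ) (s : ℚ) where
    private
      P Q : ℚ
      P = ℕ→ℚ (pow2 j)
      Q = ½ ^ℚ j

    offset-mono : ∀ {x y} → x ≤ y → (x - s) * Q ≤ (y - s) * Q
    offset-mono x≤y = *-monoʳ-≤-nonNeg Q {{nonNegative (0≤½^j j)}} (+-monoˡ-≤ (- s) x≤y)

    s≤s+2^j : s ≤ s + P
    s≤s+2^j = subst (_≤ s + P) (+-identityʳ s) (+-monoʳ-≤ s (0≤2^j j))

    offset-start : (s - s) * Q ≡ 0ℚ
    offset-start = trans (cong (_* Q) (+-inverseʳ s)) (*-zeroˡ Q)

    offset-end : (s + P - s) * Q ≡ 1ℚ
    offset-end = trans (cancel s P Q) (trans (*-comm P Q) (½^j*2^j≡1 j))
      where
      cancel : ∀ s P Q → (s + P - s) * Q ≡ P * Q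
      cancel = solve-∀ ℚ-ring

  profile-before : ∀ L y s x → x ≤ s → profile y s L x ≡ y
  profile-before []      y s x x≤s = refl
  profile-before (j ∷ L) y s x x≤s = begin
    profile (y - clamp01 ((x - s) * ½ ^ℚ j)) (s + ℕ→ℚ (pow2 j)) L x  ≡⟨ profile-before L _ _ x x≤s+2^j ⟩
    y - clamp01 ((x - s) * ½ ^ℚ j)                                  ≡⟨ cong (_-_ y) (clamp01-≤0 offset≤0) ⟩
    y - 0ℚ                                                          ≡⟨ +-identityʳ y ⟩
    y                                                               ∎
    where
    open ≡-Reasoning
    x≤s+2^j : x ≤ s + ℕ→ℚ (pow2 j)
    x≤s+2^j = ≤-trans x≤s (s≤s+2^j j s)
    offset≤0 : (x - s) * ½ ^ℚ j ≤ 0ℚ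
    offset≤0 = subst ((x - s) * ½ ^ℚ j ≤_) (offset-start j s) (offset-mono j s x≤s)

  profile-past : ∀ j L y s x → s + ℕ→ℚ (pow2 j) ≤ x → profile y s (j ∷ L) x ≡ profile (y - 1ℚ) (s + ℕ→ℚ (pow2 j)) L x
  profile-past j L y s x s+2^j≤x =
    cong (λ c → profile (y - c) _ L x) (clamp01-≥1 (subst (_≤ (x - s) * ½ ^ℚ j) (offset-end j s) (offset-mono j s s+2^j≤x)))

  profile-within : ∀ j L y s x → s ≤ x → x ≤ s + ℕ→ℚ (pow2 j) → profile y s (j ∷ L) x ≡ y - (x - s) * ½ ^ℚ j
  profile-within j L y s x s≤x x≤s+2^j = trans (profile-before L _ _ x x≤s+2^j) (cong (_-_ y) (clamp01-[0,1]
    (subst (_≤ (x - s) * ½ ^ℚ j) (offset-start j s) (offset-mono j s s≤x))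
    (subst ((x - s) * ½ ^ℚ j ≤_) (offset-end j s) (offset-mono j s x≤s+2^j))))

  -- x lies over the piece [lo, lo + 2^b] of the profile; lo < 2^b collects the binary digits of n below b.
  record Segment (j₁ n : ℕ) (x v : ℚ) : Set where
    field
      b g lo   : ℕ
      n≡       : n ≡ lo ℕ.+ pow2 b ℕ.* suc (2 ℕ.* g)
      lo<2^b   : lo ℕ.< pow2 b
      2^j₁∣lo  : pow2 j₁ ∣ lo
      j₁≤b     : j₁ ℕ.≤ b
      lo≤x     : ℕ→ℚ lo ≤ x
      x≤lo+2^b : x ≤ ℕ→ℚ (lo ℕ.+ pow2 b)
      v≡       : v ≡ ℕ→ℚ (s₂ (suc (2 ℕ.* g))) - (x - ℕ→ℚ lo) * ½ ^ℚ b

  segment-here : ∀ j₁ b L lo x → Linked ℕ._<_ (b ∷ L) → lo ℕ.< pow2 b → pow2 j₁ ∣ lo → j₁ ℕ.≤ b →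
                 ℕ→ℚ lo ≤ x → x ≤ ℕ→ℚ (lo ℕ.+ pow2 b) →
                 Segment j₁ (lo ℕ.+ sum (map pow2 (b ∷ L))) x (profile (ℕ→ℚ (length (b ∷ L))) (ℕ→ℚ lo) (b ∷ L) x)
  segment-here j₁ b L lo x increasing lo<2^b 2^j₁∣lo j₁≤b lo≤x x≤lo+2^b with sum-increasing-pow2 b L increasing
  ... | g , sum≡ , s₂≡ = record
    { b = b ; g = g ; lo = lo
    ; n≡ = cong (lo ℕ.+_) sum≡
    ; lo<2^b = lo<2^b ; 2^j₁∣lo = 2^j₁∣lo ; j₁≤b = j₁≤b ; lo≤x = lo≤x ; x≤lo+2^b = x≤lo+2^b
    ; v≡ = trans (profile-within b L (ℕ→ℚ (length (b ∷ L))) (ℕ→ℚ lo) x lo≤x (subst (x ≤_) (ℕ→ℚ-+ lo (pow2 b)) x≤lo+2^b))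
                 (cong (λ k → ℕ→ℚ k - (x - ℕ→ℚ lo) * ½ ^ℚ b) (sym s₂≡))
    }

  segment : ∀ j₁ b L lo x → Linked ℕ._<_ (b ∷ L) → lo ℕ.< pow2 b → pow2 j₁ ∣ lo → j₁ ℕ.≤ b →
            ℕ→ℚ lo ≤ x → x ≤ ℕ→ℚ (lo ℕ.+ sum (map pow2 (b ∷ L))) →
            Segment j₁ (lo ℕ.+ sum (map pow2 (b ∷ L))) x (profile (ℕ→ℚ (length (b ∷ L))) (ℕ→ℚ lo) (b ∷ L) x)
  segment j₁ b [] lo x increasing lo<2^b 2^j₁∣lo j₁≤b lo≤x x≤end =
    segment-here j₁ b [] lo x increasing lo<2^b 2^j₁∣lo j₁≤b lo≤x
      (subst (λ k → x ≤ ℕ→ℚ (lo ℕ.+ k)) (ℕ.+-identityʳ (pow2 b)) x≤end)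
  segment j₁ b (b′ ∷ L′) lo x increasing@(b<b′ ∷ increasing′) lo<2^b 2^j₁∣lo j₁≤b lo≤x x≤end
    with ≤-total x (ℕ→ℚ (lo ℕ.+ pow2 b))
  ... | inj₁ x≤lo+2^b = segment-here j₁ b (b′ ∷ L′) lo x increasing lo<2^b 2^j₁∣lo j₁≤b lo≤x x≤lo+2^b
  ... | inj₂ lo+2^b≤x = subst₂ (λ n v → Segment j₁ n x v) (ℕ.+-assoc lo (pow2 b) _) (sym next-piece)
    (segment j₁ b′ L′ (lo ℕ.+ pow2 b) x increasing′ lo′<2^b′ (∣m∣n⇒∣m+n 2^j₁∣lo (2^-mono-∣ j₁≤b))
      (ℕ.≤-trans j₁≤b (ℕ.<⇒≤ b<b′)) lo+2^b≤x (subst (x ≤_) (cong ℕ→ℚ (sym (ℕ.+-assoc lo (pow2 b) _))) x≤end))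
    where
    lo′<2^b′ : lo ℕ.+ pow2 b ℕ.< pow2 b′
    lo′<2^b′ = ℕ.<-≤-trans (ℕ.+-monoˡ-< (pow2 b) lo<2^b)
      (ℕ.≤-trans (ℕ.≤-reflexive (cong (pow2 b ℕ.+_) (sym (ℕ.+-identityʳ (pow2 b))))) (ℕ.^-monoʳ-≤ 2 b<b′))
    drop-one : ℕ→ℚ (length (b ∷ b′ ∷ L′)) - 1ℚ ≡ ℕ→ℚ (length (b′ ∷ L′))
    drop-one = trans (cong (_- 1ℚ) (ℕ→ℚ-+ 1 (length (b′ ∷ L′)))) (cancel (ℕ→ℚ (length (b′ ∷ L′))))
      where
      cancel : ∀ a → 1ℚ + a - 1ℚ ≡ a
      cancel = solve-∀ ℚ-ring
    next-piece : profile (ℕ→ℚ (length (b ∷ b′ ∷ L′))) (ℕ→ℚ lo) (b ∷ b′ ∷ L′) x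
               ≡ profile (ℕ→ℚ (length (b′ ∷ L′))) (ℕ→ℚ (lo ℕ.+ pow2 b)) (b′ ∷ L′) x
    next-piece = trans
      (profile-past b (b′ ∷ L′) (ℕ→ℚ (length (b ∷ b′ ∷ L′))) (ℕ→ℚ lo) x (subst (_≤ x) (ℕ→ℚ-+ lo (pow2 b)) lo+2^b≤x))
                       (cong₂ (λ y s → profile y s (b′ ∷ L′) x) drop-one (sym (ℕ→ℚ-+ lo (pow2 b))))

module SupportingLine where

  open import Data.Rational using (ℚ; _+_; _*_; _-_; -_; _≤_; _<_; 0ℚ; nonNegative)
  open import Data.Rational.Properties
  open import Data.Product using (_,_)
  open import Data.Sum using (inj₂)
  open import Relation.Binary.PropositionalEquality
  open import Tactic.RingSolver using (solve-∀)
  open import Defs using (NP; InSupp; ptX; ptY)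
  open RationalCasts

  Affine : (ℚ → ℚ) → Set
  Affine ℓ = ∀ X₁ X₂ x → (X₂ - X₁) * ℓ x ≡ (X₂ - x) * ℓ X₁ + (x - X₁) * ℓ X₂

  line-affine : ∀ A L Q → Affine (λ X → A - (X - L) * Q)
  line-affine A L Q X₁ X₂ x = identity A L Q X₁ X₂ x
    where
    identity : ∀ A L Q X₁ X₂ x → (X₂ - X₁) * (A - (x - L) * Q)
                                ≡ (X₂ - x) * (A - (X₁ - L) * Q) + (x - X₁) * (A - (X₂ - L) * Q)
    identity = solve-∀ ℚ-ring

  p≤q⇒0≤q-p : ∀ {p q} → p ≤ q → 0ℚ ≤ q - p
  p≤q⇒0≤q-p {p} {q} p≤q = subst (_≤ q - p) (+-inverseʳ p) (+-monoˡ-≤ (- p) p≤q)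

  NP-supportingLine : ∀ {n f} ℓ → Affine ℓ → (∀ j → InSupp n f j → ℓ (ptX n j) ≤ ptY f j) →
                      ∀ {i₁ i₂ x} → InSupp n f i₁ → InSupp n f i₂ → ptX n i₁ < ptX n i₂ →
                      ptY f i₁ ≡ ℓ (ptX n i₁) → ptY f i₂ ≡ ℓ (ptX n i₂) →
                      ptX n i₁ ≤ x → x ≤ ptX n i₂ → NP n f x (ℓ x)
  NP-supportingLine {n} {f} ℓ affine below {i₁} {i₂} {x} supp₁ supp₂ X₁<X₂ Y₁≡ Y₂≡ X₁≤x x≤X₂ =
    inj₂ (i₁ , i₂ , supp₁ , supp₂ , X₁<X₂ , X₁≤x , x≤X₂ , on-chord) ,
    (λ j supp X≡x → subst (λ X → ℓ X ≤ ptY f j) X≡x (below j supp)) ,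
    below-chord
    where
    on-chord : (ptX n i₂ - ptX n i₁) * ℓ x ≡ (ptX n i₂ - x) * ptY f i₁ + (x - ptX n i₁) * ptY f i₂
    on-chord = trans (affine (ptX n i₁) (ptX n i₂) x)
                     (sym (cong₂ (λ y₁ y₂ → (ptX n i₂ - x) * y₁ + (x - ptX n i₁) * y₂) Y₁≡ Y₂≡))
    below-chord : ∀ j₁ j₂ → InSupp n f j₁ → InSupp n f j₂ → ptX n j₁ < ptX n j₂ →
                  ptX n j₁ ≤ x → x ≤ ptX n j₂ →
                  (ptX n j₂ - ptX n j₁) * ℓ x ≤ (ptX n j₂ - x) * ptY f j₁ + (x - ptX n j₁) * ptY f j₂
    below-chord j₁ j₂ s₁ s₂ _ Xj₁≤x x≤Xj₂ =
      subst (_≤ (ptX n j₂ - x) * ptY f j₁ + (x - ptX n j₁) * ptY f j₂) (sym (affine (ptX n j₁) (ptX n j₂) x))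
      (+-mono-≤ (*-monoˡ-≤-nonNeg (ptX n j₂ - x) {{nonNegative (p≤q⇒0≤q-p x≤Xj₂)}} (below j₁ s₁))
                (*-monoˡ-≤-nonNeg (x - ptX n j₁) {{nonNegative (p≤q⇒0≤q-p Xj₁≤x)}} (below j₂ s₂)))

module NewtonPolygonOfK where

  open import Data.Nat as ℕ using (ℕ; suc; _∸_)
  import Data.Nat.Properties as ℕ
  import Data.Nat.Tactic.RingSolver as ℕ-Solver
  open import Data.Nat.Divisibility using (_∣_; ∣m∣n⇒∣m+n)
  open import Data.Nat.Combinatorics using (_C_)
  open import Data.Rational using (ℚ; _+_; _*_; _-_; -_; _≤_; _<_; 0ℚ; 1ℚ; ½; positive)
  open import Data.Rational.Properties
  open import Data.Product using (_,_)
  open import Relation.Binary.PropositionalEquality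
  open import Tactic.RingSolver using (solve-∀)
  open import Defs using (ℕ→ℚ; ℤ→ℚ; _^ℚ_; pow2; K; NP; InSupp; ptX; ptY; v₂)
  open BinaryDigits
  open RationalCasts
  open TwoAdicValuation
  open CoefficientsOfK
  open Profile
  open SupportingLine

  C-odd-shifted : ∀ {n t i c} → i ℕ.≤ n → n ℕ.≤ t → t ℕ.< n ℕ.+ 2 ℕ.^ c → 2 ℕ.^ c ∣ n ∸ i →
                  Odd ((t ∸ i) C (n ∸ i))
  C-odd-shifted {n} {t} {i} {c} i≤n n≤t t<n+2^c 2^c∣n∸i =
    subst (λ m → Odd (m C (n ∸ i))) t∸i≡ (C-odd {c = c} 2^c∣n∸i (ℕ.+-cancelˡ-< n _ _ (subst (ℕ._< _) (sym n+r≡t) t<n+2^c)))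
    where
    n+r≡t : n ℕ.+ (t ∸ n) ≡ t
    n+r≡t = ℕ.m+[n∸m]≡n n≤t
    t∸i≡ : n ∸ i ℕ.+ (t ∸ n) ≡ t ∸ i
    t∸i≡ = trans (sym (ℕ.+-∸-comm (t ∸ n) i≤n)) (cong (_∸ i) n+r≡t)

  below-line : ∀ P Q A L X I H E → 0ℚ < P → P * Q ≡ 1ℚ → X + I ≡ L + P * H → P * A + I ≤ P * (E + H) →
               A - (X - L) * Q ≤ E
  below-line P Q A L X I H E P>0 P*Q≡1 X+I≡ scaled =
    *-cancelˡ-≤-pos P {{positive P>0}} (subst₂ _≤_ (sym lhs) (cancel P E H) (+-monoˡ-≤ (- (P * H)) scaled))
    where
    open ≡-Reasoning
    cancel : ∀ P E H → P * (E + H) - P * H ≡ P * E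
    cancel = solve-∀ ℚ-ring
    expand : ∀ P Q A L X I → P * (A - (X - L) * Q) ≡ P * A + I - (X + I - L) - (X - L) * (P * Q - 1ℚ)
    expand = solve-∀ ℚ-ring
    lhs : P * (A - (X - L) * Q) ≡ P * A + I - P * H
    lhs = begin
      P * (A - (X - L) * Q)                                ≡⟨ expand P Q A L X I ⟩
      P * A + I - (X + I - L) - (X - L) * (P * Q - 1ℚ)     ≡⟨ cong₂ (λ u w → P * A + I - (u - L) - (X - L) * (w - 1ℚ)) X+I≡ P*Q≡1 ⟩
      P * A + I - (L + P * H - L) - (X - L) * (1ℚ - 1ℚ)    ≡⟨ simplify P A I L H X ⟩
      P * A + I - P * H                                    ∎
      where
      simplify : ∀ P A I L H X → P * A + I - (L + P * H - L) - (X - L) * (1ℚ - 1ℚ) ≡ P * A + I - P * H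
      simplify = solve-∀ ℚ-ring

  module _ {n t j₁ x v} (n≤t : n ℕ.≤ t) (t<n+2^j₁ : t ℕ.< n ℕ.+ pow2 j₁) (seg : Segment j₁ n x v) where
    open Segment seg
    open ≡-Reasoning

    f : ℕ → ℚ
    f = K n t

    B h i₁ i₂ : ℕ
    B = pow2 b
    h = suc (2 ℕ.* g)
    i₁ = B ℕ.* h
    i₂ = pow2 (suc b) ℕ.* g

    ℓ : ℚ → ℚ
    ℓ X = ℕ→ℚ (s₂ h) - (X - ℕ→ℚ lo) * ½ ^ℚ b

    n≡lo+B+i₂ : n ≡ lo ℕ.+ B ℕ.+ i₂
    n≡lo+B+i₂ = trans n≡ (regroup lo B g)
      where
      regroup : ∀ lo B g → lo ℕ.+ B ℕ.* suc (2 ℕ.* g) ≡ lo ℕ.+ B ℕ.+ 2 ℕ.* B ℕ.* g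
      regroup = ℕ-Solver.solve-∀
    n∸i₁≡lo : n ∸ i₁ ≡ lo
    n∸i₁≡lo = trans (cong (_∸ i₁) n≡) (ℕ.m+n∸n≡m lo i₁)
    n∸i₂≡lo+B : n ∸ i₂ ≡ lo ℕ.+ B
    n∸i₂≡lo+B = trans (cong (_∸ i₂) n≡lo+B+i₂) (ℕ.m+n∸n≡m (lo ℕ.+ B) i₂)
    i₁≤n : i₁ ℕ.≤ n
    i₁≤n = subst (i₁ ℕ.≤_) (sym n≡) (ℕ.m≤n+m i₁ lo)
    i₂≤n : i₂ ℕ.≤ n
    i₂≤n = subst (i₂ ℕ.≤_) (sym n≡lo+B+i₂) (ℕ.m≤n+m i₂ (lo ℕ.+ B))
    n<B+i₁ : n ℕ.< B ℕ.+ i₁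
    n<B+i₁ = subst (ℕ._< B ℕ.+ i₁) (sym n≡) (ℕ.+-monoˡ-< i₁ lo<2^b)
    n<₁ : n ℕ.< B ℕ.* suc h
    n<₁ = subst (n ℕ.<_) (sym (ℕ.*-suc B h)) n<B+i₁
    n<₂ : n ℕ.< pow2 (suc b) ℕ.* suc g
    n<₂ = subst (n ℕ.<_) (regroup B g) n<B+i₁
      where
      regroup : ∀ B g → B ℕ.+ B ℕ.* suc (2 ℕ.* g) ≡ 2 ℕ.* B ℕ.* suc g
      regroup = ℕ-Solver.solve-∀

    V₁ : Val₂≡ (s₂ h) (f i₁)
    V₁ = K-vertex n t b h i₁≤n n<₁
           (C-odd-shifted {c = j₁} i₁≤n n≤t t<n+2^j₁ (subst (pow2 j₁ ∣_) (sym n∸i₁≡lo) 2^j₁∣lo))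
    V₂ : Val₂≡ (s₂ g) (f i₂)
    V₂ = K-vertex n t (suc b) g i₂≤n n<₂
           (C-odd-shifted {c = j₁} i₂≤n n≤t t<n+2^j₁
             (subst (pow2 j₁ ∣_) (sym n∸i₂≡lo+B) (∣m∣n⇒∣m+n 2^j₁∣lo (2^-mono-∣ j₁≤b))))

    X₁≡ : ptX n i₁ ≡ ℕ→ℚ lo
    X₁≡ = cong ℕ→ℚ n∸i₁≡lo
    X₂≡ : ptX n i₂ ≡ ℕ→ℚ (lo ℕ.+ B)
    X₂≡ = cong ℕ→ℚ n∸i₂≡lo+B
    X₁<X₂ : ptX n i₁ < ptX n i₂
    X₁<X₂ = subst₂ _<_ (sym X₁≡) (sym X₂≡) (ℕ→ℚ-mono-< (ℕ.m<m+n lo (ℕ.m^n>0 2 b)))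

    Y₁≡ : ptY f i₁ ≡ ℓ (ptX n i₁)
    Y₁≡ = begin
      ℤ→ℚ (v₂ (f i₁))                               ≡⟨ cong ℤ→ℚ (Val₂≡⇒v₂≡ V₁) ⟩
      ℕ→ℚ (s₂ h)                                     ≡⟨ +-identityʳ (ℕ→ℚ (s₂ h)) ⟨
      ℕ→ℚ (s₂ h) - 0ℚ                                ≡⟨ cong (_-_ (ℕ→ℚ (s₂ h))) (offset-start b (ℕ→ℚ lo)) ⟨
      ℓ (ℕ→ℚ lo)                                     ≡⟨ cong ℓ X₁≡ ⟨
      ℓ (ptX n i₁)                                   ∎
    Y₂≡ : ptY f i₂ ≡ ℓ (ptX n i₂)
    Y₂≡ = begin
      ℤ→ℚ (v₂ (f i₂))                               ≡⟨ cong ℤ→ℚ (Val₂≡⇒v₂≡ V₂) ⟩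
      ℕ→ℚ (s₂ g)                                     ≡⟨ cancel (ℕ→ℚ (s₂ g)) ⟨
      1ℚ + ℕ→ℚ (s₂ g) - 1ℚ                           ≡⟨ cong₂ _-_ (trans (cong ℕ→ℚ (s₂-1+2* g)) (ℕ→ℚ-+ 1 (s₂ g)))
                                                                  (offset-end b (ℕ→ℚ lo)) ⟨
      ℕ→ℚ (s₂ h) - (ℕ→ℚ lo + ℕ→ℚ B - ℕ→ℚ lo) * ½ ^ℚ b ≡⟨ cong ℓ (trans (sym (ℕ→ℚ-+ lo B)) (sym X₂≡)) ⟩
      ℓ (ptX n i₂)                                   ∎
      where
      cancel : ∀ a → 1ℚ + a - 1ℚ ≡ a
      cancel = solve-∀ ℚ-ring
    below-ℓ : ∀ j → InSupp n f j → ℓ (ptX n j) ≤ ptY f j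
    below-ℓ j (j≤n , fj≢0) = let e , above , bound = K-above-line n t b h n<₁ j≤n in ≤-trans
      (below-line (ℕ→ℚ B) (½ ^ℚ b) (ℕ→ℚ (s₂ h)) (ℕ→ℚ lo) (ℕ→ℚ (n ∸ j)) (ℕ→ℚ j) (ℕ→ℚ h) (ℕ→ℚ e)
        (ℕ→ℚ-mono-< (ℕ.m^n>0 2 b)) (trans (*-comm (ℕ→ℚ B) (½ ^ℚ b)) (½^j*2^j≡1 b)) (X+I≡ j≤n) (cast above))
      (ℤ→ℚ-mono-≤ (Val₂≥⇒v₂≥ bound fj≢0))
      where
      X+I≡ : ∀ {j} → j ℕ.≤ n → ℕ→ℚ (n ∸ j) + ℕ→ℚ j ≡ ℕ→ℚ lo + ℕ→ℚ B * ℕ→ℚ h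
      X+I≡ {j} j≤n = begin
        ℕ→ℚ (n ∸ j) + ℕ→ℚ j         ≡⟨ ℕ→ℚ-+ (n ∸ j) j ⟨
        ℕ→ℚ (n ∸ j ℕ.+ j)           ≡⟨ cong ℕ→ℚ (trans (ℕ.m∸n+n≡m j≤n) n≡) ⟩
        ℕ→ℚ (lo ℕ.+ B ℕ.* h)        ≡⟨ ℕ→ℚ-+ lo (B ℕ.* h) ⟩
        ℕ→ℚ lo + ℕ→ℚ (B ℕ.* h)      ≡⟨ cong (_+_ (ℕ→ℚ lo)) (ℕ→ℚ-* B h) ⟩
        ℕ→ℚ lo + ℕ→ℚ B * ℕ→ℚ h      ∎
      cast : ∀ {j e} → B ℕ.* s₂ h ℕ.+ j ℕ.≤ B ℕ.* (e ℕ.+ h) →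
             ℕ→ℚ B * ℕ→ℚ (s₂ h) + ℕ→ℚ j ≤ ℕ→ℚ B * (ℕ→ℚ e + ℕ→ℚ h)
      cast {j} {e} le = subst₂ _≤_
        (trans (ℕ→ℚ-+ (B ℕ.* s₂ h) j) (cong (_+ ℕ→ℚ j) (ℕ→ℚ-* B (s₂ h))))
        (trans (ℕ→ℚ-* B (e ℕ.+ h)) (cong (ℕ→ℚ B *_) (ℕ→ℚ-+ e h)))
        (ℕ→ℚ-mono-≤ le)

    NP-on-segment : NP n (K n t) x v
    NP-on-segment = subst (NP n f x) (sym v≡)
      (NP-supportingLine ℓ (line-affine (ℕ→ℚ (s₂ h)) (ℕ→ℚ lo) (½ ^ℚ b)) below-ℓ
        (i₁≤n , Val₂≡⇒≢0 V₁) (i₂≤n , Val₂≡⇒≢0 V₂) X₁<X₂ Y₁≡ Y₂≡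
        (subst (_≤ x) (sym X₁≡) lo≤x) (subst (x ≤_) (sym X₂≡) x≤lo+2^b))

open import Defs
open import Data.Nat using (ℕ; _≤_; _<_; _+_)
open import Data.List using (List; _∷_; map)
open import Data.Nat.ListAction using (sum)
open import Data.List.Relation.Unary.Linked using (Linked)
open import Data.Rational using (ℚ) renaming (_≤_ to _≤ℚ_)
open import Data.Product using (Σ)
open import Relation.Binary.PropositionalEquality using (_≡_)

open import Data.List using (length)
open import Data.Nat.Divisibility using (_∣0)
open import Data.Nat.Properties using (m^n>0; ≤-refl)
open import Data.Product using (_,_)
open import Relation.Binary.PropositionalEquality using (sym; subst)
open Profile using (Segment; segment)
open NewtonPolygonOfK using (NP-on-segment)

theorem1p2 : (n : ℕ) → 1 ≤ n →
    (j₁ : ℕ) (js : List ℕ) →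
    Linked _<_ (j₁ ∷ js) →
    n ≡ sum (map pow2 (j₁ ∷ js)) →
    (t : ℕ) → n ≤ t → t < n + pow2 j₁ →
    Σ ℚ λ y₀ → (x : ℚ) → ℕ→ℚ 0 ≤ℚ x → x ≤ℚ ℕ→ℚ n →
      NP n (K n t) x (profile y₀ (ℕ→ℚ 0) (j₁ ∷ js) x)
theorem1p2 n _ j₁ js increasing n≡ t n≤t t<n+2^j₁ = y₀ , on-profile
  where
  y₀ : ℚ
  y₀ = ℕ→ℚ (length (j₁ ∷ js))
  on-profile : (x : ℚ) → ℕ→ℚ 0 ≤ℚ x → x ≤ℚ ℕ→ℚ n → NP n (K n t) x (profile y₀ (ℕ→ℚ 0) (j₁ ∷ js) x)
  on-profile x 0≤x x≤n = NP-on-segment {n} {t} {j₁} {x} {profile y₀ (ℕ→ℚ 0) (j₁ ∷ js) x} n≤t t<n+2^j₁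
    (subst (λ m → Segment j₁ m x (profile y₀ (ℕ→ℚ 0) (j₁ ∷ js) x)) (sym n≡)
      (segment j₁ j₁ js 0 x increasing (m^n>0 2 j₁) (pow2 j₁ ∣0) ≤-refl 0≤x (subst (λ m → x ≤ℚ ℕ→ℚ m) n≡ x≤n)))
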